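{- In the setting described in the context, let $\mathcal{O}\in B(k)\backslash G(k)/K(k)$ satisfy $\mathcal{S}(\mathcal{O})=-\mathcal{S}(\mathcal{O})$. If $\mathcal{S}(\mathcal{O})$ contains no horizontal edge, then $\mathcal{O}\cap G^{\varphi}(k)\neq\emptyset$.
   Context: Let $k$ be a field with $\operatorname{char}k\ne2$, $m,n\ge0$, $N=m+n$, $I=[-N,-1]\cup[1,N]$ naturally ordered. $U$ has basis $(e_j)_{j\in I}$ and symplectic form with $\langle e_{ -j},e_j\rangle=1$ for $j>0$, $\langle e_i,e_j\rangle=0$ if $i+j\ne0$. $G=GL(U)$; $U_i=\mathrm{span}\{e_j:j\le i\}$ and $B$ is the stabilizer of the flag $(U_i)_{i\in I}$; $U^{2m}=\mathrm{span}\{e_j:|j|\le m\}$, $U^{2n}=\mathrm{span}\{e_j:|j|>m\}$, $K$ the stabilizer of both. $\varphi$ is the involution of $G$ with $\langle v,w\rangle=\langle gv,\varphi(g)w\rangle$; $G^\varphi=Sp(U)$. $C_{2N}$ has vertices $v_i,w_i$ ($i\in I$), edges $v_iv_j$ ($i\ne j$) and $v_iw_i$; the minus involution $\mathcal{S}\mapsto-\mathcal{S}$ on sets of edges is induced by $v_i\leftrightarrow v_{ -i}$, $w_i\leftrightarrow w_{ -i}$; an edge is horizontal if it joins $v_i$ and $v_{ -i}$. For $g\in G(k)$, the flag $(U_i)$ with $A=gU^{2m}$, $A'=gU^{2n}$ is a representation of the type $D_{2N+2}$ quiver and decomposes uniquely up to isomorphism into indecomposables of three kinds: (a) dimension $1$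 at $U_j$ for $j\ge i$, $0$ before, $1$ at $A$, $0$ at $A'$; (b) the same with $A,A'$ swapped; (c) for some $i<j$: dimension $1$ at $U_l$ for $i\le l<j$, $2$ for $l\ge j$, $0$ before $i$, $1$ at each of $A,A'$. $\mathcal{S}(B(k)gK(k))$ is the set of edges $v_iw_i$ for kind (a) summands and $v_iv_j$ for kind (c) summands; this is a bijection from $B(k)\backslash G(k)/K(k)$ onto the $2m$-matchings of $C_{2N}$. -}

module Defs where

open import Level using (Level; _⊔_; suc)
open import Data.Nat using (ℕ) renaming (_+_ to _+ℕ_; _≤_ to _≤ℕ_; _<_ to _<ℕ_)
open import Data.Unit using (⊤)
open import Data.Empty using (⊥)
open import Data.Fin using (Fin; toℕ; opposite; _≟_) renaming (_<_ to _<ᶠ_)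
import Data.Fin as F
open import Data.Product using (Σ; _×_; ∃)
open import Relation.Nullary using (¬_; yes; no)
open import Relation.Binary.PropositionalEquality using (_≡_; _≢_)
open import Data.Nat using (_<?_)
open import Algebra.Bundles using (CommutativeRing)

record Field (c ℓ : Level) : Set (Level.suc (c ⊔ ℓ)) where
  field
    commutativeRing : CommutativeRing c ℓ
  open CommutativeRing commutativeRing public
  field
    0≉1     : ¬ (0# ≈ 1#)
    inverse : ∀ x → ¬ (x ≈ 0#) → Σ Carrier (λ y → x * y ≈ 1#)

CharNot2 : ∀ {c ℓ} → Field c ℓ → Set ℓ
CharNot2 k = ¬ ((1# + 1#) ≈ 0#) where open Field k

-- Index set I = [-N,-1] ∪ [1,N] is encoded as Fin (2N), order preserved:
-- position p ↦ p - N if p < N, and p - N + 1 if p ≥ N.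
-- The minus map i ↦ -i is Fin.opposite.

dim : ℕ → ℕ → ℕ
dim m n = (m +ℕ n) +ℕ (m +ℕ n)

module LinAlg {c ℓ} (k : Field c ℓ) where
  open Field k

  Vec : ℕ → Set c
  Vec d = Fin d → Carrier

  Mat : ℕ → Set c
  Mat d = Fin d → Fin d → Carrier

  Σᶠ : ∀ {d} → (Fin d → Carrier) → Carrier
  Σᶠ {ℕ.zero} f  = 0#
  Σᶠ {ℕ.suc d} f = f F.zero + Σᶠ (λ i → f (F.suc i))

  _·_ : ∀ {d} → Mat d → Mat d → Mat d
  (a · b) i j = Σᶠ (λ l → a i l * b l j)

  _ᵀ : ∀ {d} → Mat d → Mat d
  (a ᵀ) i j = a j i

  idM : ∀ {d} → Mat d
  idM i j with i ≟ j
  ... | yes _ = 1#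
  ... | no _  = 0#

  _≈M_ : ∀ {d} → Mat d → Mat d → Set ℓ
  a ≈M b = ∀ i j → a i j ≈ b i j

  _≈V_ : ∀ {d} → Vec d → Vec d → Set ℓ
  u ≈V v = ∀ i → u i ≈ v i

  Invertible : ∀ {d} → Mat d → Set (c ⊔ ℓ)
  Invertible a = Σ (Mat _) (λ a' → (a · a') ≈M idM × (a' · a) ≈M idM)

  col : ∀ {d} → Mat d → Fin d → Vec d
  col a j i = a i j

  InSpan : ∀ {d} → (P : Fin d → Set) → (Fin d → Vec d) → Vec d → Set (c ⊔ ℓ)
  InSpan P f v = Σ (Fin _ → Carrier) λ a →
    (∀ p → ¬ P p → a p ≈ 0#) × (∀ i → v i ≈ Σᶠ (λ p → a p * f p i))

  SameSpan : ∀ {d} → (Fin d → Set) → (Fin d → Vec d) →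
             (Fin d → Set) → (Fin d → Vec d) → Set (c ⊔ ℓ)
  SameSpan P f P' f' =
    (∀ p → P p → InSpan P' f' (f p)) × (∀ p → P' p → InSpan P f (f' p))

module Setting {c ℓ} (k : Field c ℓ) (m n : ℕ) where
  open Field k
  open LinAlg k public

  d : ℕ
  d = dim m n

  Neg : Fin d → Set
  Neg p = toℕ p <ℕ m +ℕ n

  -- U^{2m} = span{e_j : |j| ≤ m}, i.e. positions n ≤ p < n + 2m
  Inner : Fin d → Set
  Inner p = (n ≤ℕ toℕ p) × (toℕ p <ℕ n +ℕ (m +ℕ m))

  -- B: stabilizer of the flag U_i = span{e_j : j ≤ i}
  InB : Mat d → Set (c ⊔ ℓ)
  InB b = Invertible b × (∀ i j → j <ᶠ i → b i j ≈ 0#)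

  -- K: stabilizer of U^{2m} and U^{2n}
  InK : Mat d → Set (c ⊔ ℓ)
  InK κ = Invertible κ ×
    ((∀ i j → Inner j → ¬ Inner i → κ i j ≈ 0#) ×
     (∀ i j → ¬ Inner j → Inner i → κ i j ≈ 0#))

  -- Gram matrix of the symplectic form:
  -- ⟨e_{-j}, e_j⟩ = 1, ⟨e_j, e_{-j}⟩ = -1 (j > 0), others 0.
  J : Mat d
  J p q with q ≟ opposite p | toℕ p <? (m +ℕ n)
  ... | yes _ | yes _ = 1#
  ... | yes _ | no _  = - 1#
  ... | no _  | _     = 0#

  -- G^φ(k): g ∈ GL(U) with φ(g) = g, i.e. ⟨v,w⟩ = ⟨gv,gw⟩ for all v,w,
  -- i.e. gᵀ J g = J.
  InGφ : Mat d → Set (c ⊔ ℓ)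
  InGφ g = Invertible g × (((g ᵀ) · J) · g) ≈M J

  -- Edges of C_{2N}.  An unordered edge v_p v_q is represented by both
  -- ordered pairs (vv p q) and (vv q p); edge sets are symmetric.
  data Edge : Set where
    vv : Fin d → Fin d → Edge
    vw : Fin d → Edge

  neg : Edge → Edge
  neg (vv p q) = vv (opposite p) (opposite q)
  neg (vw p)   = vw (opposite p)

  Horizontal : Edge → Set
  Horizontal (vv p q) = q ≡ opposite p
  Horizontal (vw p)   = ⊥

  -- Decomposition of the D_{2N+2} representation ((U_i), gU^{2m}, gU^{2n})
  -- into indecomposables.  Every summand is "started" at a jump of the
  -- flag; role p records which summand position p belongs to:
  --   kindA   : summand (a) starting at p
  --   kindB   : summand (b) starting at p
  --   kindC q : summand (c) with {i,j} = {p,q}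
  data Role : Set where
    kindA kindB : Role
    kindC : Fin d → Role

  -- Standard model of the summands, realised through an adapted basis
  -- u_p = h e_p (h ∈ B, so h(U_i) = U_i):
  --   (a) at i : line u_i, lying in A;
  --   (b) at i : line u_i, lying in A';
  --   (c) at i<j : plane ⟨u_i,u_j⟩, A ∩ it = ⟨u_j⟩, A' ∩ it = ⟨u_i + u_j⟩.
  -- An isomorphism of representations from the direct sum of the model
  -- summands to ((U_i), gU^{2m}, gU^{2n}) is exactly such an h with
  -- A_model = gU^{2m}, A'_model = gU^{2n}.
  InA : (Fin d → Role) → Fin d → Set
  InA role p with role p
  ... | kindA   = ⊤
  ... | kindB   = ⊥
  ... | kindC q = q <ᶠ p

  InA' : (Fin d → Role) → Fin d → Set
  InA' role p with role p
  ... | kindA   = ⊥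
  ... | kindB   = ⊤
  ... | kindC q = p <ᶠ q

  -- generator of A' ∩ (summand containing p): u_p, or u_p + u_q for (c)
  wvec : (Fin d → Role) → Mat d → Fin d → Vec d
  wvec role h p with role p
  ... | kindC q = λ i → col h p i + col h q i
  ... | _       = col h p

  record Decomposition (g : Mat d) : Set (c ⊔ ℓ) where
    field
      role     : Fin d → Role
      partner  : ∀ p q → role p ≡ kindC q → role q ≡ kindC p
      distinct : ∀ p q → role p ≡ kindC q → p ≢ q
      h        : Mat d
      h∈B      : InB h
      A≡gU2m   : SameSpan (InA role) (col h) Inner (col g)
      A'≡gU2n  : SameSpan (InA' role) (wvec role h) (λ p → ¬ Inner p) (col g)

  -- S(BgK) computed from a decomposition:
  -- edges v_i w_i for kind (a), v_i v_j for kind (c)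
  edges : ∀ {g} → Decomposition g → Edge → Set
  edges D (vw p)   = Decomposition.role D p ≡ kindA
  edges D (vv p q) = Decomposition.role D p ≡ kindC q

{-# OPTIONS --safe #-}
module Submission where

-- Work in the basis u = h e adapted to the decomposition.  A summand of kind (a) or (b) at x
-- is the line of u x, lying in A or A′; a summand of kind (c) at q < p contributes u p ∈ A and
-- u q + u p ∈ A′.  Since S(O) = −S(O) has no horizontal edge, the (c)-summands come in
-- disjoint quadruples {q, p, −p, −q}.  Let w x be these generators (u x, or u x + u (mate x)
-- at the lower end of a (c)-summand).  An upper triangular involution t acting inside each
-- quadruple makes the vectors f x = t (w x) pairwise orthogonal for the symplectic form except
-- for ⟨f x, f (−mate x)⟩ = ±1.  Comparing two bases of A shows that 2m of the w x lie in A, so a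
-- permutation β matching the indices of U^{2m} with them, compatible with j ↦ −j and
-- x ↦ −mate x, and signs ε turn (ε j f (β j)) into a symplectic basis.  Then with b = t h⁻¹ ∈ B
-- and κ = g⁻¹ h C ∈ K, where C has columns ε j w (β j), the matrix b g κ = t C is symplectic.

open import Defs
open import Data.Nat using (ℕ)
open import Data.Product using (Σ; _×_; _,_)
open import Function.Bundles using (_⇔_)
open import Relation.Nullary using (¬_)

module Counting where

  open import Data.Bool.Base using (Bool; true; false; not; if_then_else_)
  import Data.Bool.Properties as Bool
  open import Data.Empty using (⊥-elim)
  open import Data.Fin.Base using (Fin; zero; suc; toℕ; punchIn; opposite; _↑ˡ_; _↑ʳ_; splitAt)
  open import Data.Fin.Permutation as Perm
    using (Permutation; _⟨$⟩ʳ_; _⟨$⟩ˡ_; permutation; insert; insert-punchIn)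
  import Data.Fin.Properties as Fin
  open import Data.Nat.Base using (zero; suc; _+_; _∸_; _≤_; _<_; z≤n; s≤s; ⌊_/2⌋)
  import Data.Nat.Properties as ℕ
  open import Data.Product.Base using (Σ-syntax; ∃)
  open import Data.Sum.Base using (inj₁; inj₂; [_,_]′)
  open import Function.Base using (_∘_)
  open import Relation.Binary.PropositionalEquality
  open import Relation.Nullary using (Dec; yes; no; does)
  open import Relation.Nullary.Decidable using (dec-true; dec-false)
  open import Algebra.Properties.CommutativeMonoid.Sum ℕ.+-0-commutativeMonoid
    using (sum; sum-remove; sum-permute)

  true≢false : true ≢ false
  true≢false ()

  does-true : ∀ {a} {A : Set a} (a? : Dec A) → does a? ≡ true → A
  does-true (yes a) _ = a

  indicator : Bool → ℕ
  indicator true  = 1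
  indicator false = 0

  count : ∀ {n} → (Fin n → Bool) → ℕ
  count P = sum (indicator ∘ P)

  count-cong : ∀ {n} {P Q : Fin n → Bool} → (∀ x → P x ≡ Q x) → count P ≡ count Q
  count-cong {zero}  P≗Q = refl
  count-cong {suc n} P≗Q = cong₂ _+_ (cong indicator (P≗Q zero)) (count-cong (P≗Q ∘ suc))

  count-permute : ∀ {n} (π : Permutation n n) (P : Fin n → Bool) → count (P ∘ (π ⟨$⟩ʳ_)) ≡ count P
  count-permute π P = sym (sum-permute (indicator ∘ P) π)

  count-remove : ∀ {n} (P : Fin (suc n) → Bool) (i : Fin (suc n)) →
                 count P ≡ indicator (P i) + count (P ∘ punchIn i)
  count-remove P i = sum-remove {i = i} (indicator ∘ P)

  count-≤ : ∀ {n} (P : Fin n → Bool) → count P ≤ n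
  count-≤ {zero}  P = z≤n
  count-≤ {suc n} P with P zero
  ... | true  = s≤s (count-≤ (P ∘ suc))
  ... | false = ℕ.m≤n⇒m≤1+n (count-≤ (P ∘ suc))

  count-const : ∀ {n} b → count {n} (λ _ → b) ≡ (if b then n else 0)
  count-const {zero}  true  = refl
  count-const {zero}  false = refl
  count-const {suc n} true  = cong suc (count-const true)
  count-const {suc n} false = count-const {n} false

  count≡0⇒false : ∀ {n} (P : Fin n → Bool) → count P ≡ 0 → ∀ x → P x ≡ false
  count≡0⇒false {suc n} P c≡0 x with P x in Px
  ... | false = refl
  ... | true  = ⊥-elim (ℕ.1+n≢0 (trans (cong (λ b → indicator b + count (P ∘ punchIn x)) (sym Px))
                                        (trans (sym (count-remove P x)) c≡0)))

  0<count⇒true : ∀ {n} (P : Fin n → Bool) → 0 < count P → ∃ λ x → P x ≡ true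
  0<count⇒true {n} P 0<c with Fin.any? (λ x → P x Bool.≟ true)
  ... | yes found = found
  ... | no none   = ⊥-elim (ℕ.<-irrefl (sym (trans (count-cong (λ x → Bool.¬-not (λ Px → none (x , Px))))
                                                 (count-const {n} false))) 0<c)

  without : ∀ {n} → (Fin n → Bool) → Fin n → Fin n → Bool
  without P x₀ x = if does (x Fin.≟ x₀) then false else P x

  without-self : ∀ {n} (P : Fin n → Bool) x₀ → without P x₀ x₀ ≡ false
  without-self P x₀ rewrite dec-true (x₀ Fin.≟ x₀) refl = refl

  without-other : ∀ {n} (P : Fin n → Bool) {x₀ x} → x ≢ x₀ → without P x₀ x ≡ P x
  without-other P {x₀} {x} x≢x₀ rewrite dec-false (x Fin.≟ x₀) x≢x₀ = refl

  count-without : ∀ {n} (P : Fin n → Bool) x₀ → P x₀ ≡ true → count P ≡ suc (count (without P x₀))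
  count-without {suc n} P x₀ Px₀ = begin
    count P                                                       ≡⟨ count-remove P x₀ ⟩
    indicator (P x₀) + count (P ∘ punchIn x₀)                     ≡⟨ cong (λ b → indicator b + count (P ∘ punchIn x₀)) Px₀ ⟩
    suc (count (P ∘ punchIn x₀))                                  ≡⟨ cong suc (count-cong (λ y → sym (without-other P (Fin.punchInᵢ≢i x₀ y)))) ⟩
    suc (count (without P x₀ ∘ punchIn x₀))
      ≡⟨ cong (λ b → suc (indicator b + count (without P x₀ ∘ punchIn x₀))) (without-self P x₀) ⟨
    suc (indicator (without P x₀ x₀) + count (without P x₀ ∘ punchIn x₀)) ≡⟨ cong suc (count-remove (without P x₀) x₀) ⟨
    suc (count (without P x₀))                                    ∎
    where open ≡-Reasoning

  -- If no y had Q y ≡ P x, then Q would be constant, with count 0 or n + 1, which P cannot match.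
  preimage : ∀ {n} (P Q : Fin (suc n) → Bool) → count P ≡ count Q → ∀ x → ∃ λ y → Q y ≡ P x
  preimage {n} P Q eq x with Fin.any? (λ y → Q y Bool.≟ P x)
  ... | yes found = found
  ... | no none   = mismatch (P x) refl
    where
    counts : ∀ b → P x ≡ b → indicator b + count (P ∘ punchIn x) ≡ (if not b then suc n else 0)
    counts b refl = trans (sym (count-remove P x))
      (trans eq (trans (count-cong (λ y → Bool.¬-not (λ Qy → none (y , Qy)))) (count-const (not (P x)))))
    mismatch : ∀ b → P x ≡ b → ∃ λ y → Q y ≡ P x
    mismatch true  Px = ⊥-elim (ℕ.1+n≢0 (counts true Px))
    mismatch false Px = ⊥-elim (ℕ.n≮n n (subst (_≤ n) (counts false Px) (count-≤ (P ∘ punchIn x))))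

  matching : ∀ {n} (P Q : Fin n → Bool) → count P ≡ count Q →
             Σ[ π ∈ Permutation n n ] (∀ x → Q (π ⟨$⟩ʳ x) ≡ P x)
  matching {zero}  P Q eq = Perm.id , λ ()
  matching {suc n} P Q eq with preimage P Q eq zero
  ... | y , Qy≡P0 with matching (P ∘ suc) (Q ∘ punchIn y) tails
    where
    tails : count (P ∘ suc) ≡ count (Q ∘ punchIn y)
    tails = ℕ.+-cancelˡ-≡ (indicator (P zero)) _ _ (trans (count-remove P zero)
      (trans eq (trans (count-remove Q y) (cong (λ b → indicator b + count (Q ∘ punchIn y)) Qy≡P0))))
  ...   | π , πQ = insert zero y π , preserves
    where
    preserves : ∀ x → Q (insert zero y π ⟨$⟩ʳ x) ≡ P x
    preserves zero    = Qy≡P0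
    preserves (suc x) = trans (cong Q (insert-punchIn zero y π x)) (πQ x)

  count-↑ : ∀ N {M} (P : Fin (N + M) → Bool) → count P ≡ count (P ∘ (_↑ˡ M)) + count (P ∘ (N ↑ʳ_))
  count-↑ zero    P = refl
  count-↑ (suc N) P = trans (cong (indicator (P zero) +_) (count-↑ N (P ∘ suc)))
                            (sym (ℕ.+-assoc (indicator (P zero)) _ _))

  opposite-↑ˡ : ∀ N (i : Fin N) → opposite (i ↑ˡ N) ≡ N ↑ʳ opposite i
  opposite-↑ˡ N i = Fin.toℕ-injective (begin
    toℕ (opposite (i ↑ˡ N))      ≡⟨ Fin.opposite-prop (i ↑ˡ N) ⟩
    (N + N) ∸ suc (toℕ (i ↑ˡ N)) ≡⟨ cong (λ j → (N + N) ∸ suc j) (Fin.toℕ-↑ˡ i N) ⟩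
    (N + N) ∸ suc (toℕ i)        ≡⟨ ℕ.+-∸-assoc N (Fin.toℕ<n i) ⟩
    N + (N ∸ suc (toℕ i))        ≡⟨ cong (N +_) (Fin.opposite-prop i) ⟨
    N + toℕ (opposite i)         ≡⟨ Fin.toℕ-↑ʳ N (opposite i) ⟨
    toℕ (N ↑ʳ opposite i)        ∎)
    where open ≡-Reasoning

  left-or-opposite : ∀ N (R : Fin (N + N) → Set) →
                     (∀ i → R (i ↑ˡ N)) → (∀ i → R (opposite (i ↑ˡ N))) → ∀ x → R x
  left-or-opposite N R left right x with splitAt N x in eq
  ... | inj₁ i = subst R (Fin.splitAt⁻¹-↑ˡ eq) (left i)
  ... | inj₂ i = subst R (trans (trans (opposite-↑ˡ N (opposite i)) (cong (N ↑ʳ_) (Fin.opposite-involutive i)))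
                                (Fin.splitAt⁻¹-↑ʳ eq))
                         (right (opposite i))

  count-symmetric : ∀ N (P : Fin (N + N) → Bool) → (∀ x → P (opposite x) ≡ P x) →
                    count P ≡ count (P ∘ (_↑ˡ N)) + count (P ∘ (_↑ˡ N))
  count-symmetric N P P-sym = trans (count-↑ N P) (cong (count (P ∘ (_↑ˡ N)) +_) right≡left)
    where
    right≡left : count (P ∘ (N ↑ʳ_)) ≡ count (P ∘ (_↑ˡ N))
    right≡left = trans (sym (count-permute Perm.reverse (P ∘ (N ↑ʳ_))))
      (count-cong (λ i → trans (cong P (sym (opposite-↑ˡ N i))) (P-sym (i ↑ˡ N))))

  module _ (N : ℕ) where

    mirror : (Fin N → Fin N) → Fin (N + N) → Fin (N + N)
    mirror f x = [ (λ i → f i ↑ˡ N) , (λ i → N ↑ʳ opposite (f (opposite i))) ]′ (splitAt N x)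

    mirror-↑ˡ : ∀ f i → mirror f (i ↑ˡ N) ≡ f i ↑ˡ N
    mirror-↑ˡ f i rewrite Fin.splitAt-↑ˡ N i N = refl

    mirror-opposite-↑ˡ : ∀ f i → mirror f (opposite (i ↑ˡ N)) ≡ opposite (f i ↑ˡ N)
    mirror-opposite-↑ˡ f i rewrite opposite-↑ˡ N i | Fin.splitAt-↑ʳ N N (opposite i) =
      trans (cong (λ j → N ↑ʳ opposite (f j)) (Fin.opposite-involutive i)) (sym (opposite-↑ˡ N (f i)))

    mirror-opposite : ∀ f x → mirror f (opposite x) ≡ opposite (mirror f x)
    mirror-opposite f = left-or-opposite N _
      (λ i → trans (mirror-opposite-↑ˡ f i) (cong opposite (sym (mirror-↑ˡ f i))))
      (λ i → begin
        mirror f (opposite (opposite (i ↑ˡ N))) ≡⟨ cong (mirror f) (Fin.opposite-involutive _) ⟩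
        mirror f (i ↑ˡ N)                       ≡⟨ mirror-↑ˡ f i ⟩
        f i ↑ˡ N                                ≡⟨ Fin.opposite-involutive _ ⟨
        opposite (opposite (f i ↑ˡ N))          ≡⟨ cong opposite (mirror-opposite-↑ˡ f i) ⟨
        opposite (mirror f (opposite (i ↑ˡ N))) ∎)
      where open ≡-Reasoning

    mirror-∘ : ∀ f g x → mirror f (mirror g x) ≡ mirror (f ∘ g) x
    mirror-∘ f g = left-or-opposite N _
      (λ i → trans (cong (mirror f) (mirror-↑ˡ g i)) (trans (mirror-↑ˡ f (g i)) (sym (mirror-↑ˡ (f ∘ g) i))))
      (λ i → trans (cong (mirror f) (mirror-opposite-↑ˡ g i))
        (trans (mirror-opposite-↑ˡ f (g i)) (sym (mirror-opposite-↑ˡ (f ∘ g) i))))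

    mirror-identity : ∀ {f} → (∀ i → f i ≡ i) → ∀ x → mirror f x ≡ x
    mirror-identity {f} f≗id = left-or-opposite N _
      (λ i → trans (mirror-↑ˡ f i) (cong (_↑ˡ N) (f≗id i)))
      (λ i → trans (mirror-opposite-↑ˡ f i) (cong (λ j → opposite (j ↑ˡ N)) (f≗id i)))

    symmetric-matching : (P Q : Fin (N + N) → Bool) →
      (∀ x → P (opposite x) ≡ P x) → (∀ x → Q (opposite x) ≡ Q x) → count P ≡ count Q →
      Σ[ π ∈ Permutation (N + N) (N + N) ]
        (∀ x → Q (π ⟨$⟩ʳ x) ≡ P x) × (∀ x → π ⟨$⟩ʳ opposite x ≡ opposite (π ⟨$⟩ʳ x))
    symmetric-matching P Q P-sym Q-sym eq with matching (P ∘ (_↑ˡ N)) (Q ∘ (_↑ˡ N)) halves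
      where
      halves : count (P ∘ (_↑ˡ N)) ≡ count (Q ∘ (_↑ˡ N))
      halves = trans (ℕ.n≡⌊n+n/2⌋ _) (trans (cong ⌊_/2⌋ (trans (sym (count-symmetric N P P-sym))
        (trans eq (count-symmetric N Q Q-sym)))) (sym (ℕ.n≡⌊n+n/2⌋ _)))
    ... | ρ , ρQ = π , preserves , mirror-opposite (ρ ⟨$⟩ʳ_)
      where
      π : Permutation (N + N) (N + N)
      π = permutation (mirror (ρ ⟨$⟩ʳ_)) (mirror (ρ ⟨$⟩ˡ_))
        (λ x → trans (mirror-∘ _ _ x) (mirror-identity (λ _ → Perm.inverseʳ ρ) x))
        (λ x → trans (mirror-∘ _ _ x) (mirror-identity (λ _ → Perm.inverseˡ ρ) x))
      preserves : ∀ x → Q (π ⟨$⟩ʳ x) ≡ P x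
      preserves = left-or-opposite N _
        (λ i → trans (cong Q (mirror-↑ˡ _ i)) (ρQ i))
        (λ i → begin
          Q (mirror (ρ ⟨$⟩ʳ_) (opposite (i ↑ˡ N))) ≡⟨ cong Q (mirror-opposite-↑ˡ _ i) ⟩
          Q (opposite ((ρ ⟨$⟩ʳ i) ↑ˡ N))            ≡⟨ Q-sym _ ⟩
          Q ((ρ ⟨$⟩ʳ i) ↑ˡ N)                       ≡⟨ ρQ i ⟩
          P (i ↑ˡ N)                                ≡⟨ P-sym _ ⟨
          P (opposite (i ↑ˡ N))                     ∎)
        where open ≡-Reasoning

module Matrices {c ℓ} (k : Field c ℓ) where
  open import Data.Fin.Base using (Fin; zero; suc; toℕ; punchIn) renaming (_<_ to _<ᶠ_; _>_ to _>ᶠ_)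
  open import Data.Fin.Induction using (>-wellFounded)
  open import Induction.WellFounded using (Acc; acc)
  import Data.Nat.Properties as ℕ
  open import Relation.Binary.Definitions using (tri<; tri≈; tri>)
  open import Data.Fin.Permutation using (Permutation; _⟨$⟩ʳ_)
  open import Function.Bundles using (Injection)
  open import Function.Properties.Inverse using (↔⇒↣)
  import Data.Fin.Properties as Fin
  open import Data.Nat.Base as ℕ using (zero; suc)
  open import Data.Product.Base using (proj₁; proj₂)
  open import Function.Base using (_∘_)
  open import Relation.Binary.PropositionalEquality as ≡ using (_≡_; _≢_)
  open import Relation.Nullary using (Dec; yes; no)
  open import Relation.Nullary.Decidable using (¬¬-excluded-middle)
  open import Data.Bool.Base using (Bool; true; false)
  open import Level using (_⊔_)
  open import Data.Empty using (⊥-elim)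
  open Counting
  open Field k hiding (zero)
  open LinAlg k
  open import Algebra.Properties.Semiring.Sum semiring
    using (sum; sum-cong-≋; sum-replicate-zero; sum-remove; ∑-distrib-+; sum-permute; *-distribˡ-sum; *-distribʳ-sum)
  open import Algebra.Properties.Ring ring using (-1*x≈-x; -‿distribˡ-*; -‿distribʳ-*; -‿involutive)
  open import Algebra.Properties.CommutativeSemigroup *-commutativeSemigroup
    using (x∙yz≈y∙xz; xy∙z≈zy∙x; interchange)
  open import Relation.Binary.Reasoning.Setoid setoid

  private
    variable
      d : ℕ

  Σᶠ≡sum : (f : Fin d → Carrier) → Σᶠ f ≡ sum f
  Σᶠ≡sum {zero}  f = ≡.refl
  Σᶠ≡sum {suc d} f = ≡.cong (f zero +_) (Σᶠ≡sum (f ∘ suc))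

  Σᶠ-cong : {f g : Fin d → Carrier} → (∀ i → f i ≈ g i) → Σᶠ f ≈ Σᶠ g
  Σᶠ-cong {f = f} {g} f≈g rewrite Σᶠ≡sum f | Σᶠ≡sum g = sum-cong-≋ f≈g

  Σᶠ-zero : {f : Fin d → Carrier} → (∀ i → f i ≈ 0#) → Σᶠ f ≈ 0#
  Σᶠ-zero {d} {f} f≈0 rewrite Σᶠ≡sum f = trans (sum-cong-≋ f≈0) (sum-replicate-zero d)

  Σᶠ-single : {f : Fin d → Carrier} (x : Fin d) → (∀ i → i ≢ x → f i ≈ 0#) → Σᶠ f ≈ f x
  Σᶠ-single {suc d} {f} x f≈0 rewrite Σᶠ≡sum f = begin
    sum f                          ≈⟨ sum-remove f ⟩
    f x + sum (f ∘ punchIn x)      ≈⟨ +-congˡ (trans (sum-cong-≋ (λ i → f≈0 _ (Fin.punchInᵢ≢i x i))) (sum-replicate-zero d)) ⟩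
    f x + 0#                       ≈⟨ +-identityʳ (f x) ⟩
    f x                            ∎

  Σᶠ-+ : (f g : Fin d → Carrier) → Σᶠ (λ i → f i + g i) ≈ Σᶠ f + Σᶠ g
  Σᶠ-+ f g rewrite Σᶠ≡sum f | Σᶠ≡sum g | Σᶠ≡sum (λ i → f i + g i) = ∑-distrib-+ f g

  *-Σᶠ : (a : Carrier) (f : Fin d → Carrier) → a * Σᶠ f ≈ Σᶠ (λ i → a * f i)
  *-Σᶠ a f rewrite Σᶠ≡sum f | Σᶠ≡sum (λ i → a * f i) = *-distribˡ-sum a f

  Σᶠ-* : (a : Carrier) (f : Fin d → Carrier) → Σᶠ f * a ≈ Σᶠ (λ i → f i * a)
  Σᶠ-* a f rewrite Σᶠ≡sum f | Σᶠ≡sum (λ i → f i * a) = *-distribʳ-sum a f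

  Σᶠ-permute : (π : Permutation d d) (f : Fin d → Carrier) → Σᶠ f ≈ Σᶠ (f ∘ (π ⟨$⟩ʳ_))
  Σᶠ-permute π f rewrite Σᶠ≡sum f | Σᶠ≡sum (f ∘ (π ⟨$⟩ʳ_)) = sum-permute f π

  Σᶠ-comm : ∀ {d′} (f : Fin d → Fin d′ → Carrier) →
            Σᶠ (λ i → Σᶠ (λ j → f i j)) ≈ Σᶠ (λ j → Σᶠ (λ i → f i j))
  Σᶠ-comm {zero} {d′} f = sym (Σᶠ-zero {d′} (λ _ → refl))
  Σᶠ-comm {suc d} f = trans (+-congˡ (Σᶠ-comm (f ∘ suc))) (sym (Σᶠ-+ (f zero) _))

  Σᶠ-neg : (f : Fin d → Carrier) → Σᶠ (λ i → - f i) ≈ - Σᶠ f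
  Σᶠ-neg f = begin
    Σᶠ (λ i → - f i)        ≈⟨ Σᶠ-cong (λ i → -1*x≈-x (f i)) ⟨
    Σᶠ (λ i → - 1# * f i)   ≈⟨ *-Σᶠ (- 1#) f ⟨
    - 1# * Σᶠ f             ≈⟨ -1*x≈-x (Σᶠ f) ⟩
    - Σᶠ f                  ∎

  -1*-1 : - 1# * - 1# ≈ 1#
  -1*-1 = trans (-1*x≈-x (- 1#)) (-‿involutive 1#)

  -x*-x : ∀ x → - x * - x ≈ x * x
  -x*-x x = trans (sym (-‿distribˡ-* x (- x))) (trans (-‿cong (sym (-‿distribʳ-* x x))) (-‿involutive (x * x)))

  -x*-x≈1 : ∀ {a} → a * a ≈ 1# → - a * - a ≈ 1#
  -x*-x≈1 {a} a²≈1 = trans (-x*-x a) a²≈1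

  idM-diag : (i : Fin d) → idM i i ≈ 1#
  idM-diag i with i Fin.≟ i
  ... | yes _  = refl
  ... | no i≢i = ⊥-elim (i≢i ≡.refl)

  idM-off : {i j : Fin d} → i ≢ j → idM i j ≈ 0#
  idM-off {i = i} {j} i≢j with i Fin.≟ j
  ... | yes i≡j = ⊥-elim (i≢j i≡j)
  ... | no _    = refl

  infixl 26 _+ᵥ_
  infixr 27 _⋆_
  infixr 28 _·ᵥ_

  _+ᵥ_ : Vec d → Vec d → Vec d
  (u +ᵥ v) i = u i + v i

  _⋆_ : Carrier → Vec d → Vec d
  (a ⋆ v) i = a * v i

  e : Fin d → Vec d
  e = col idM

  dot : Vec d → Vec d → Carrier
  dot u v = Σᶠ (λ i → u i * v i)

  _·ᵥ_ : Mat d → Vec d → Vec d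
  (a ·ᵥ v) i = dot (a i) v

  dot-cong : {u u′ v v′ : Vec d} → u ≈V u′ → v ≈V v′ → dot u v ≈ dot u′ v′
  dot-cong u≈u′ v≈v′ = Σᶠ-cong (λ i → *-cong (u≈u′ i) (v≈v′ i))

  dot-comm : (u v : Vec d) → dot u v ≈ dot v u
  dot-comm u v = Σᶠ-cong (λ i → *-comm (u i) (v i))

  dot-+ : (u v w : Vec d) → dot u (v +ᵥ w) ≈ dot u v + dot u w
  dot-+ u v w = trans (Σᶠ-cong (λ i → distribˡ (u i) (v i) (w i))) (Σᶠ-+ (λ i → u i * v i) (λ i → u i * w i))

  dot-⋆ : (u : Vec d) (a : Carrier) (v : Vec d) → dot u (a ⋆ v) ≈ a * dot u v
  dot-⋆ u a v = trans (Σᶠ-cong (λ i → x∙yz≈y∙xz (u i) a (v i))) (sym (*-Σᶠ a (λ i → u i * v i)))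

  dot-e : (u : Vec d) (a : Fin d) → dot u (e a) ≈ u a
  dot-e u a = trans (Σᶠ-single a (λ i i≢a → trans (*-congˡ (idM-off i≢a)) (zeroʳ (u i))))
                    (trans (*-congˡ (idM-diag a)) (*-identityʳ (u a)))

  dot-+ˡ : (u v w : Vec d) → dot (u +ᵥ v) w ≈ dot u w + dot v w
  dot-+ˡ u v w = trans (dot-comm (u +ᵥ v) w) (trans (dot-+ w u v) (+-cong (dot-comm w u) (dot-comm w v)))

  dot-⋆ˡ : (a : Carrier) (u v : Vec d) → dot (a ⋆ u) v ≈ a * dot u v
  dot-⋆ˡ a u v = trans (dot-comm (a ⋆ u) v) (trans (dot-⋆ v a u) (*-congˡ (dot-comm v u)))

  dot-eˡ : (a : Fin d) (v : Vec d) → dot (e a) v ≈ v a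
  dot-eˡ a v = trans (dot-comm (e a) v) (dot-e v a)

  ·ᵥ-cong : (a : Mat d) {u v : Vec d} → u ≈V v → a ·ᵥ u ≈V a ·ᵥ v
  ·ᵥ-cong a u≈v i = dot-cong (λ _ → refl) u≈v

  ·ᵥ-+ : (a : Mat d) (u v : Vec d) → a ·ᵥ (u +ᵥ v) ≈V a ·ᵥ u +ᵥ a ·ᵥ v
  ·ᵥ-+ a u v i = dot-+ (a i) u v

  ·ᵥ-⋆ : (a : Mat d) (x : Carrier) (v : Vec d) → a ·ᵥ (x ⋆ v) ≈V x ⋆ a ·ᵥ v
  ·ᵥ-⋆ a x v i = dot-⋆ (a i) x v

  ·ᵥ-e : (a : Mat d) (j : Fin d) → a ·ᵥ e j ≈V col a j
  ·ᵥ-e a j i = dot-e (a i) j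

  idM-·ᵥ : (v : Vec d) → idM ·ᵥ v ≈V v
  idM-·ᵥ v i = trans (Σᶠ-single i (λ l l≢i → trans (*-congʳ (idM-off (l≢i ∘ ≡.sym))) (zeroˡ (v l))))
                     (trans (*-congʳ (idM-diag i)) (*-identityˡ (v i)))

  ·ᵥ-e+e : (a : Mat d) (i j : Fin d) → a ·ᵥ (e i +ᵥ e j) ≈V col a i +ᵥ col a j
  ·ᵥ-e+e a i j z = trans (·ᵥ-+ a (e i) (e j) z) (+-cong (·ᵥ-e a i z) (·ᵥ-e a j z))

  ·ᵥ-e+⋆e : (a : Mat d) (i : Fin d) (x : Carrier) (j : Fin d) → a ·ᵥ (e i +ᵥ x ⋆ e j) ≈V col a i +ᵥ x ⋆ col a j
  ·ᵥ-e+⋆e a i x j z = trans (·ᵥ-+ a (e i) (x ⋆ e j) z) (+-cong (·ᵥ-e a i z) (trans (·ᵥ-⋆ a x (e j) z) (*-congˡ (·ᵥ-e a j z))))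

  ≈V-reflexive : {u v : Vec d} → u ≡ v → u ≈V v
  ≈V-reflexive ≡.refl i = refl

  ⋆-cong : {x y : Carrier} → x ≈ y → (v : Vec d) → x ⋆ v ≈V y ⋆ v
  ⋆-cong x≈y v i = *-congʳ x≈y

  ⋆-congʳ : (x : Carrier) {u v : Vec d} → u ≈V v → x ⋆ u ≈V x ⋆ v
  ⋆-congʳ x u≈v i = *-congˡ (u≈v i)

  ⋆-⋆ : ∀ (a b : Carrier) (v : Vec d) → a ⋆ b ⋆ v ≈V (a * b) ⋆ v
  ⋆-⋆ a b v i = sym (*-assoc a b (v i))

  1⋆ : ∀ (v : Vec d) → 1# ⋆ v ≈V v
  1⋆ v i = *-identityˡ (v i)

  cancel : ∀ (u v : Vec d) → u +ᵥ v +ᵥ (- 1#) ⋆ v ≈V u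
  cancel u v z = trans (+-congˡ (-1*x≈-x (v z))) (trans (+-assoc _ _ _) (trans (+-congˡ (-‿inverseʳ _)) (+-identityʳ _)))

  cancelˡ : ∀ (u v : Vec d) → (- 1#) ⋆ v +ᵥ (u +ᵥ v) ≈V u
  cancelˡ u v z = begin
    - 1# * v z + (u z + v z)   ≈⟨ +-cong (-1*x≈-x (v z)) (+-comm (u z) (v z)) ⟩
    - v z + (v z + u z)        ≈⟨ +-assoc (- v z) (v z) (u z) ⟨
    - v z + v z + u z          ≈⟨ +-congʳ (-‿inverseˡ (v z)) ⟩
    0# + u z                   ≈⟨ +-identityˡ (u z) ⟩
    u z                        ∎

  module VecReasoning {d : ℕ} where
    open import Data.Vec.Functional.Relation.Binary.Equality.Setoid setoid using (≋-setoid)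
    open import Relation.Binary.Reasoning.Setoid (≋-setoid d) public

  ·-·ᵥ : (a b : Mat d) (v : Vec d) → (a · b) ·ᵥ v ≈V a ·ᵥ b ·ᵥ v
  ·-·ᵥ a b v i = begin
    Σᶠ (λ l → Σᶠ (λ j → a i j * b j l) * v l)   ≈⟨ Σᶠ-cong (λ l → Σᶠ-* (v l) (λ j → a i j * b j l)) ⟩
    Σᶠ (λ l → Σᶠ (λ j → a i j * b j l * v l))   ≈⟨ Σᶠ-comm (λ l j → a i j * b j l * v l) ⟩
    Σᶠ (λ j → Σᶠ (λ l → a i j * b j l * v l))   ≈⟨ Σᶠ-cong (λ j → trans (Σᶠ-cong (λ l → *-assoc (a i j) (b j l) (v l)))
                                                                           (sym (*-Σᶠ (a i j) (λ l → b j l * v l)))) ⟩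
    Σᶠ (λ j → a i j * Σᶠ (λ l → b j l * v l))   ∎

  ·-cong : {a a′ b b′ : Mat d} → a ≈M a′ → b ≈M b′ → (a · b) ≈M (a′ · b′)
  ·-cong a≈a′ b≈b′ i j = dot-cong (a≈a′ i) (λ l → b≈b′ l j)

  ·-assoc : (a b c : Mat d) → ((a · b) · c) ≈M (a · (b · c))
  ·-assoc a b c i j = ·-·ᵥ a b (col c j) i

  ·-identityˡ : (a : Mat d) → (idM · a) ≈M a
  ·-identityˡ a i j = idM-·ᵥ (col a j) i

  ≈M-trans : {a b c : Mat d} → a ≈M b → b ≈M c → a ≈M c
  ≈M-trans a≈b b≈c i j = trans (a≈b i j) (b≈c i j)

  ·-cancel-middle : (a b b′ c : Mat d) → (b · b′) ≈M idM → ((a · b) · (b′ · c)) ≈M (a · c)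
  ·-cancel-middle a b b′ c bb′≈1 = ≈M-trans (·-assoc a b (b′ · c)) (·-cong (λ _ _ → refl)
    (≈M-trans (λ i j → sym (·-assoc b b′ c i j)) (≈M-trans (·-cong bb′≈1 (λ _ _ → refl)) (·-identityˡ c))))

  Invertible-· : {a b : Mat d} → Invertible a → Invertible b → Invertible (a · b)
  Invertible-· {a = a} {b} (a′ , aa′≈1 , a′a≈1) (b′ , bb′≈1 , b′b≈1) =
    (b′ · a′) , ≈M-trans (·-cancel-middle a b b′ a′ bb′≈1) aa′≈1
              , ≈M-trans (·-cancel-middle b′ a′ a b a′a≈1) b′b≈1

  UpperTriangular : Mat d → Set ℓ
  UpperTriangular a = ∀ i j → j <ᶠ i → a i j ≈ 0#

  UpperTriangular-· : {a b : Mat d} → UpperTriangular a → UpperTriangular b → UpperTriangular (a · b)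
  UpperTriangular-· {a = a} {b} a-ut b-ut i j j<i = Σᶠ-zero term
    where
    term : ∀ l → a i l * b l j ≈ 0#
    term l with Fin.<-cmp l i
    ... | tri< l<i _ _ = trans (*-congʳ (a-ut i l l<i)) (zeroˡ (b l j))
    ... | tri≈ _ ≡.refl _ = trans (*-congˡ (b-ut l j j<i)) (zeroʳ (a i l))
    ... | tri> _ _ i<l = trans (*-congˡ (b-ut l j (Fin.<-trans j<i i<l))) (zeroʳ (a i l))

  -- Descending from the last row: once the rows of a′ below row i are upper triangular,
  -- row i of a · a′ left of the diagonal is a i i times row i of a′.
  UpperTriangular-inverse : {a a′ : Mat d} → UpperTriangular a → (a · a′) ≈M idM → UpperTriangular a′
  UpperTriangular-inverse {a = a} {a′} a-ut aa′≈1 i = row i (>-wellFounded i)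
    where
    row : ∀ i → Acc _>ᶠ_ i → ∀ j → j <ᶠ i → a′ i j ≈ 0#
    row i (acc below) j j<i = begin
      a′ i j                       ≈⟨ *-identityʳ (a′ i j) ⟨
      a′ i j * 1#                  ≈⟨ *-congˡ pivot ⟨
      a′ i j * (a i i * a′ i i)    ≈⟨ x∙yz≈y∙xz (a′ i j) (a i i) (a′ i i) ⟩
      a i i * (a′ i j * a′ i i)    ≈⟨ *-assoc (a i i) (a′ i j) (a′ i i) ⟨
      a i i * a′ i j * a′ i i      ≈⟨ *-congʳ (trans (sym (diagonal j (ℕ.<⇒≤ j<i))) (trans (aa′≈1 i j) (idM-off (Fin.<⇒≢ j<i ∘ ≡.sym)))) ⟩
      0# * a′ i i                  ≈⟨ zeroˡ (a′ i i) ⟩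
      0#                           ∎
      where
      diagonal : ∀ j → toℕ j ℕ.≤ toℕ i → (a · a′) i j ≈ a i i * a′ i j
      diagonal j j≤i = Σᶠ-single i term
        where
        term : ∀ l → l ≢ i → a i l * a′ l j ≈ 0#
        term l l≢i with Fin.<-cmp l i
        ... | tri< l<i _ _ = trans (*-congʳ (a-ut i l l<i)) (zeroˡ (a′ l j))
        ... | tri≈ _ l≡i _ = ⊥-elim (l≢i l≡i)
        ... | tri> _ _ i<l = trans (*-congˡ (row l (below i<l) j (ℕ.≤-<-trans j≤i i<l))) (zeroʳ (a i l))
      pivot : a i i * a′ i i ≈ 1#
      pivot = trans (sym (diagonal i ℕ.≤-refl)) (trans (aa′≈1 i i) (idM-diag i))

  form : Mat d → Vec d → Vec d → Carrier
  form a u v = dot (λ l → dot u (col a l)) v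

  form-cong : (a : Mat d) {u u′ v v′ : Vec d} → u ≈V u′ → v ≈V v′ → form a u v ≈ form a u′ v′
  form-cong a u≈u′ v≈v′ = dot-cong (λ l → dot-cong u≈u′ (λ _ → refl)) v≈v′

  form-+ˡ : (a : Mat d) (u u′ v : Vec d) → form a (u +ᵥ u′) v ≈ form a u v + form a u′ v
  form-+ˡ a u u′ v = trans (dot-cong (λ l → dot-+ˡ u u′ (col a l)) (λ _ → refl))
                           (dot-+ˡ (λ l → dot u (col a l)) (λ l → dot u′ (col a l)) v)

  form-+ʳ : (a : Mat d) (u v v′ : Vec d) → form a u (v +ᵥ v′) ≈ form a u v + form a u v′
  form-+ʳ a u = dot-+ (λ l → dot u (col a l))

  form-⋆ˡ : (a : Mat d) (x : Carrier) (u v : Vec d) → form a (x ⋆ u) v ≈ x * form a u v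
  form-⋆ˡ a x u v = trans (dot-cong (λ l → dot-⋆ˡ x u (col a l)) (λ _ → refl))
                          (dot-⋆ˡ x (λ l → dot u (col a l)) v)

  form-⋆ʳ : (a : Mat d) (x : Carrier) (u v : Vec d) → form a u (x ⋆ v) ≈ x * form a u v
  form-⋆ʳ a x u v = dot-⋆ (λ l → dot u (col a l)) x v

  form-e : (a : Mat d) (i j : Fin d) → form a (e i) (e j) ≈ a i j
  form-e a i j = trans (dot-e (λ l → dot (e i) (col a l)) j) (dot-eˡ i (col a j))

  form-zero : (a : Mat d) (u v : Vec d) → (∀ i l → u i * a i l * v l ≈ 0#) → form a u v ≈ 0#
  form-zero a u v terms≈0 = Σᶠ-zero (λ l → trans (Σᶠ-* (v l) (λ i → u i * a i l)) (Σᶠ-zero (λ i → terms≈0 i l)))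

  form-transpose : (a : Mat d) (u v : Vec d) → form a u v ≈ form (a ᵀ) v u
  form-transpose a u v = begin
    Σᶠ (λ l → Σᶠ (λ i → u i * a i l) * v l)   ≈⟨ Σᶠ-cong (λ l → Σᶠ-* (v l) (λ i → u i * a i l)) ⟩
    Σᶠ (λ l → Σᶠ (λ i → u i * a i l * v l))   ≈⟨ Σᶠ-comm (λ l i → u i * a i l * v l) ⟩
    Σᶠ (λ i → Σᶠ (λ l → u i * a i l * v l))   ≈⟨ Σᶠ-cong (λ i → Σᶠ-cong (λ l → xy∙z≈zy∙x (u i) (a i l) (v l))) ⟩
    Σᶠ (λ i → Σᶠ (λ l → v l * a i l * u i))   ≈⟨ Σᶠ-cong (λ i → Σᶠ-* (u i) (λ l → v l * a i l)) ⟨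
    Σᶠ (λ i → Σᶠ (λ l → v l * a i l) * u i)   ∎

  form-antisymmetric : (a : Mat d) → (∀ i j → a j i ≈ - a i j) → (u v : Vec d) → form a u v ≈ - form a v u
  form-antisymmetric a a-anti u v = begin
    form a u v                                    ≈⟨ form-transpose a u v ⟩
    Σᶠ (λ i → Σᶠ (λ l → v l * a i l) * u i)       ≈⟨ Σᶠ-cong (λ i → *-congʳ (Σᶠ-cong (λ l → *-congˡ (a-anti l i)))) ⟩
    Σᶠ (λ i → Σᶠ (λ l → v l * - a l i) * u i)
      ≈⟨ Σᶠ-cong (λ i → *-congʳ (trans (Σᶠ-cong (λ l → sym (-‿distribʳ-* (v l) (a l i)))) (Σᶠ-neg (λ l → v l * a l i)))) ⟩
    Σᶠ (λ i → - Σᶠ (λ l → v l * a l i) * u i)     ≈⟨ Σᶠ-cong (λ i → sym (-‿distribˡ-* (Σᶠ (λ l → v l * a l i)) (u i))) ⟩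
    Σᶠ (λ i → - (Σᶠ (λ l → v l * a l i) * u i))   ≈⟨ Σᶠ-neg (λ i → Σᶠ (λ l → v l * a l i) * u i) ⟩
    - form a v u                                  ∎

  ·ᵥ-congˡ : {a b : Mat d} → a ≈M b → (v : Vec d) → a ·ᵥ v ≈V b ·ᵥ v
  ·ᵥ-congˡ a≈b v i = dot-cong (a≈b i) (λ _ → refl)

  coordinates : {x y : Mat d} → (y · x) ≈M idM → ∀ {P v} (v∈ : InSpan P (col x) v) → y ·ᵥ v ≈V proj₁ v∈
  coordinates {x = x} {y} yx≈1 {v = v} (α , _ , v≈) i = begin
    (y ·ᵥ v) i            ≈⟨ ·ᵥ-cong y (λ j → trans (v≈ j) (dot-comm α (x j))) i ⟩
    (y ·ᵥ x ·ᵥ α) i       ≈⟨ ·-·ᵥ y x α i ⟨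
    ((y · x) ·ᵥ α) i      ≈⟨ ·ᵥ-congˡ yx≈1 α i ⟩
    (idM ·ᵥ α) i          ≈⟨ idM-·ᵥ α i ⟩
    α i                   ∎

  coordinate-outside : {x y : Mat d} → (y · x) ≈M idM → ∀ {P v} → InSpan P (col x) v →
                       ∀ i → ¬ P i → (y ·ᵥ v) i ≈ 0#
  coordinate-outside yx≈1 v∈ i ¬Pi = trans (coordinates yx≈1 v∈ i) (proj₁ (proj₂ v∈) i ¬Pi)

  InSpan-resp : ∀ {P : Fin d → Set} {f : Fin d → Vec d} {u v : Vec d} → u ≈V v → InSpan P f u → InSpan P f v
  InSpan-resp u≈v (α , α-supp , u≈) = α , α-supp , (λ i → trans (sym (u≈v i)) (u≈ i))

  Supported : (Fin d → Bool) → Vec d → Set ℓ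
  Supported P v = ∀ i → P i ≡ false → v i ≈ 0#

  ·ᵥ-supported : ∀ {P : Fin d → Bool} {a : Mat d} {v : Vec d} y →
                 (∀ x → P x ≡ true → a y x ≈ 0#) → Supported P v → (a ·ᵥ v) y ≈ 0#
  ·ᵥ-supported {P = P} {a} {v} y row-zero v-supp = Σᶠ-zero term
    where
    term : ∀ x → a y x * v x ≈ 0#
    term x with P x in Px
    ... | true  = trans (*-congʳ (row-zero x Px)) (zeroˡ (v x))
    ... | false = trans (*-congˡ (v-supp x Px)) (zeroʳ (a y x))

  InjectiveOn : (P Q : Fin d → Bool) → Mat d → Set (c ⊔ ℓ)
  InjectiveOn P Q a = ∀ v → Supported P v → (∀ i → Q i ≡ true → (a ·ᵥ v) i ≈ 0#) → ∀ i → v i ≈ 0#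

  ¬¬-∀ : {R : Fin d → Set ℓ} → (∀ i → ¬ ¬ R i) → ¬ ¬ (∀ i → R i)
  ¬¬-∀ {zero}  _ k = k (λ ())
  ¬¬-∀ {suc d} h k = h zero (λ R0 → ¬¬-∀ (h ∘ suc) (λ Rs → k (λ { zero → R0 ; (suc i) → Rs i })))

  -- Gaussian elimination on a row y₀ of Q: a pivot in it removes y₀ and one column of P,
  -- and a row vanishing on P can be dropped.  Equality in k is not decidable, hence ¬¬.
  no-injection : ∀ n {P Q : Fin d → Bool} {a : Mat d} → count Q ≡ n → n ℕ.< count P → ¬ InjectiveOn P Q a
  no-injection zero {P} {Q} {a} Q-empty 0<P inj with 0<count⇒true P 0<P
  ... | x₀ , Px₀ = 0≉1 (sym (trans (sym (idM-diag x₀)) (inj (e x₀) supported rows x₀)))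
    where
    supported : Supported P (e x₀)
    supported i Pi = idM-off (λ i≡x₀ → true≢false (≡.trans (≡.sym Px₀) (≡.trans (≡.cong P (≡.sym i≡x₀)) Pi)))
    rows : ∀ i → Q i ≡ true → (a ·ᵥ e x₀) i ≈ 0#
    rows i Qi = ⊥-elim (true≢false (≡.trans (≡.sym Qi) (count≡0⇒false Q Q-empty i)))
  no-injection {d} (suc n) {P} {Q} {a} Q-size n<P inj with 0<count⇒true Q (≡.subst (0 ℕ.<_) (≡.sym Q-size) (ℕ.s≤s ℕ.z≤n))
  ... | y₀ , Qy₀ = ¬¬-excluded-middle {A = Σ (Fin d) λ x → P x ≡ true × ¬ (a y₀ x ≈ 0#)} λ
    { (yes (x₀ , Px₀ , pivot)) → no-injection n Q′-size (ℕ.≤-pred (≡.subst (suc n ℕ.<_) (count-without P x₀ Px₀) n<P))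
                                      (eliminate x₀ Px₀ (inverse (a y₀ x₀) pivot))
    ; (no no-pivot) → ¬¬-∀ (λ x k → k (λ Px → ⊥-elim (no-pivot (x , Px , λ a≈0 → k (λ _ → a≈0)))))
                       λ row-zero → no-injection n Q′-size (ℕ.<-trans (ℕ.n<1+n n) n<P) (drop row-zero)
    }
    where
    Q′ = without Q y₀
    Q′-size : count Q′ ≡ n
    Q′-size = ℕ.suc-injective (≡.trans (≡.sym (count-without Q y₀ Qy₀)) Q-size)
    drop : (∀ x → P x ≡ true → a y₀ x ≈ 0#) → InjectiveOn P Q′ a
    drop row-zero v v-supp Q′-rows = inj v v-supp rows
      where
      rows : ∀ y → Q y ≡ true → (a ·ᵥ v) y ≈ 0#
      rows y Qy with y Fin.≟ y₀
      ... | yes ≡.refl = ·ᵥ-supported {a = a} y row-zero v-supp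
      ... | no y≢y₀ = Q′-rows y (≡.trans (without-other Q y≢y₀) Qy)
    eliminated : Fin d → Carrier → Mat d
    eliminated x₀ α y x = a y x + - (a y x₀ * α) * a y₀ x

    eliminate : ∀ x₀ → P x₀ ≡ true → (inv : Σ Carrier λ α → a y₀ x₀ * α ≈ 1#) →
                InjectiveOn (without P x₀) Q′ (eliminated x₀ (proj₁ inv))
    eliminate x₀ Px₀ (α , aα≈1) v′ v′-supp Q′-rows = v′≈0
      where
      s = (a ·ᵥ v′) y₀
      γ = - (α * s)
      v = v′ +ᵥ γ ⋆ e x₀
      a·v : ∀ y → (a ·ᵥ v) y ≈ (a ·ᵥ v′) y + γ * a y x₀
      a·v y = trans (·ᵥ-+ a v′ (γ ⋆ e x₀) y) (+-congˡ (trans (·ᵥ-⋆ a γ (e x₀) y) (*-congˡ (·ᵥ-e a x₀ y))))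
      -a*α*s≈γ*a : ∀ b → - (b * α) * s ≈ γ * b
      -a*α*s≈γ*a b = begin
        - (b * α) * s      ≈⟨ -‿distribˡ-* (b * α) s ⟨
        - (b * α * s)      ≈⟨ -‿cong (trans (*-assoc b α s) (*-comm b (α * s))) ⟩
        - (α * s * b)      ≈⟨ -‿distribˡ-* (α * s) b ⟩
        γ * b              ∎
      a′·v′ : ∀ y → (eliminated x₀ α ·ᵥ v′) y ≈ (a ·ᵥ v′) y + γ * a y x₀
      a′·v′ y = begin
        dot (a y +ᵥ (- (a y x₀ * α)) ⋆ a y₀) v′   ≈⟨ dot-+ˡ (a y) _ v′ ⟩
        (a ·ᵥ v′) y + dot ((- (a y x₀ * α)) ⋆ a y₀) v′ ≈⟨ +-congˡ (dot-⋆ˡ (- (a y x₀ * α)) (a y₀) v′) ⟩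
        (a ·ᵥ v′) y + - (a y x₀ * α) * s          ≈⟨ +-congˡ (-a*α*s≈γ*a (a y x₀)) ⟩
        (a ·ᵥ v′) y + γ * a y x₀                  ∎
      rows : ∀ y → Q y ≡ true → (a ·ᵥ v) y ≈ 0#
      rows y Qy with y Fin.≟ y₀
      ... | yes ≡.refl = begin
        (a ·ᵥ v) y₀               ≈⟨ a·v y₀ ⟩
        s + γ * a y₀ x₀           ≈⟨ +-congˡ (trans (sym (-a*α*s≈γ*a (a y₀ x₀))) (trans (*-congʳ (-‿cong aα≈1)) (-1*x≈-x s))) ⟩
        s + - s                   ≈⟨ -‿inverseʳ s ⟩
        0#                        ∎
      ... | no y≢y₀ = trans (a·v y) (trans (sym (a′·v′ y)) (Q′-rows y (≡.trans (without-other Q y≢y₀) Qy)))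
      supported : Supported P v
      supported i Pi = trans (+-cong (v′-supp i (≡.trans (without-other P i≢x₀) Pi)) (trans (*-congˡ (idM-off i≢x₀)) (zeroʳ γ))) (+-identityˡ 0#)
        where
        i≢x₀ : i ≢ x₀
        i≢x₀ i≡x₀ = true≢false (≡.trans (≡.sym Px₀) (≡.trans (≡.cong P (≡.sym i≡x₀)) Pi))
      v≈0 : ∀ i → v i ≈ 0#
      v≈0 = inj v supported rows
      v′≈0 : ∀ i → v′ i ≈ 0#
      v′≈0 i = by-cases (i Fin.≟ x₀)
        where
        by-cases : Dec (i ≡ x₀) → v′ i ≈ 0#
        by-cases (yes ≡.refl) = v′-supp i (without-self P i)
        by-cases (no i≢x₀) = trans (sym (trans (+-congˡ (trans (*-congˡ (idM-off i≢x₀)) (zeroʳ γ))) (+-identityʳ (v′ i)))) (v≈0 i)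

  InjectiveOn⇒count-≤ : {P Q : Fin d → Bool} {a : Mat d} → InjectiveOn P Q a → count P ℕ.≤ count Q
  InjectiveOn⇒count-≤ inj = ℕ.≮⇒≥ (λ Q<P → no-injection _ ≡.refl Q<P inj)

  left-invertible⇒count-≤ : {P Q : Fin d → Bool} {a b : Mat d} → (b · a) ≈M idM →
    (∀ y → Q y ≡ false → ∀ x → P x ≡ true → a y x ≈ 0#) → count P ℕ.≤ count Q
  left-invertible⇒count-≤ {P = P} {Q} {a} {b} ba≈1 a-maps = InjectiveOn⇒count-≤ injective
    where
    injective : InjectiveOn P Q a
    injective v v-supp Q-rows i = begin
      v i                   ≈⟨ idM-·ᵥ v i ⟨
      (idM ·ᵥ v) i          ≈⟨ ·ᵥ-congˡ ba≈1 v i ⟨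
      ((b · a) ·ᵥ v) i      ≈⟨ ·-·ᵥ b a v i ⟩
      (b ·ᵥ a ·ᵥ v) i       ≈⟨ Σᶠ-zero (λ y → trans (*-congˡ (rows y)) (zeroʳ (b i y))) ⟩
      0#                    ∎
      where
      rows : ∀ y → (a ·ᵥ v) y ≈ 0#
      rows y with Q y in Qy
      ... | true  = Q-rows y Qy
      ... | false = ·ᵥ-supported {a = a} y (a-maps y Qy) v-supp

  Invertible-permute-rescale : {a : Mat d} → Invertible a → (β : Permutation d d) (ε : Fin d → Carrier) →
    (∀ j → ε j * ε j ≈ 1#) → Invertible (λ l j → ε j * a l (β ⟨$⟩ʳ j))
  Invertible-permute-rescale {d} {a = a} (a′ , aa′≈1 , a′a≈1) β ε ε²≈1 = c′ , cc′≈1 , c′c≈1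
    where
    c′ : Mat d
    c′ j l = ε j * a′ (β ⟨$⟩ʳ j) l
    rescale : ∀ j x y → ε j * x * (ε j * y) ≈ x * y
    rescale j x y = trans (interchange (ε j) x (ε j) y) (trans (*-congʳ (ε²≈1 j)) (*-identityˡ (x * y)))
    cc′≈1 : ((λ l j → ε j * a l (β ⟨$⟩ʳ j)) · c′) ≈M idM
    cc′≈1 z l = begin
      Σᶠ (λ j → ε j * a z (β ⟨$⟩ʳ j) * (ε j * a′ (β ⟨$⟩ʳ j) l)) ≈⟨ Σᶠ-cong (λ j → rescale j (a z (β ⟨$⟩ʳ j)) (a′ (β ⟨$⟩ʳ j) l)) ⟩
      Σᶠ (λ j → a z (β ⟨$⟩ʳ j) * a′ (β ⟨$⟩ʳ j) l)               ≈⟨ Σᶠ-permute β (λ x → a z x * a′ x l) ⟨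
      (a · a′) z l                                              ≈⟨ aa′≈1 z l ⟩
      idM z l                                                   ∎
    c′c≈1 : (c′ · (λ l j → ε j * a l (β ⟨$⟩ʳ j))) ≈M idM
    c′c≈1 j k = begin
      Σᶠ (λ l → ε j * a′ (β ⟨$⟩ʳ j) l * (ε k * a l (β ⟨$⟩ʳ k)))
        ≈⟨ Σᶠ-cong (λ l → interchange (ε j) (a′ (β ⟨$⟩ʳ j) l) (ε k) (a l (β ⟨$⟩ʳ k))) ⟩
      Σᶠ (λ l → ε j * ε k * (a′ (β ⟨$⟩ʳ j) l * a l (β ⟨$⟩ʳ k)))
        ≈⟨ *-Σᶠ (ε j * ε k) (λ l → a′ (β ⟨$⟩ʳ j) l * a l (β ⟨$⟩ʳ k)) ⟨
      ε j * ε k * (a′ · a) (β ⟨$⟩ʳ j) (β ⟨$⟩ʳ k)                ≈⟨ *-congˡ (a′a≈1 _ _) ⟩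
      ε j * ε k * idM (β ⟨$⟩ʳ j) (β ⟨$⟩ʳ k)                      ≈⟨ diagonal (j Fin.≟ k) ⟩
      idM j k                                                   ∎
      where
      diagonal : Dec (j ≡ k) → ε j * ε k * idM (β ⟨$⟩ʳ j) (β ⟨$⟩ʳ k) ≈ idM j k
      diagonal (yes ≡.refl) = trans (*-cong (ε²≈1 j) (idM-diag (β ⟨$⟩ʳ j))) (trans (*-identityʳ 1#) (sym (idM-diag j)))
      diagonal (no j≢k) = trans (*-congˡ (idM-off (j≢k ∘ Injection.injective (↔⇒↣ β)))) (trans (zeroʳ _) (sym (idM-off j≢k)))

module SymplecticForm {c ℓ} (k : Field c ℓ) (m n : ℕ) where
  open import Data.Bool.Base using (Bool; true; false; if_then_else_)
  open import Data.Unit using (tt)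
  open import Data.Empty using (⊥-elim)
  open import Data.Fin.Base using (Fin; toℕ; opposite) renaming (_<_ to _<ᶠ_)
  import Data.Fin.Properties as Fin
  import Data.Nat.Base as ℕ
  import Data.Nat.Properties as ℕP
  open import Data.Nat.Solver using (module +-*-Solver)
  open import Data.Product.Base using (Σ-syntax; proj₁; proj₂)
  open import Data.Sum.Base using (_⊎_; inj₁; inj₂)
  import Data.Sum
  open import Function.Base using (_∘_)
  open import Data.Fin.Permutation using (Permutation; _⟨$⟩ʳ_; permutation; _∘ₚ_)
  open import Function.Properties.Inverse using (↔⇒↣)
  open import Function.Bundles using (Equivalence; Injection; mk⇔)
  open import Relation.Binary.PropositionalEquality as ≡ using (_≡_; _≢_)
  open import Relation.Nullary using (Dec; yes; no; does)
  open import Relation.Nullary.Decidable using (dec-true; dec-false; does-⇔; _×-dec_)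
  import Relation.Binary.Reasoning.Setoid
  open Field k hiding (zero)
  open Setting k m n
  open Counting
  open Matrices k
  open import Algebra.Properties.Ring ring using (-‿involutive; -0#≈0#; -1*x≈-x; -‿distribˡ-*; -‿distribʳ-*)
  open import Algebra.Properties.CommutativeSemigroup *-commutativeSemigroup using (interchange)
  module ≈-Reasoning = Relation.Binary.Reasoning.Setoid setoid

  N : ℕ
  N = m ℕ.+ n

  opposite-toℕ : (x : Fin d) → toℕ (opposite x) ℕ.+ ℕ.suc (toℕ x) ≡ d
  opposite-toℕ x = ≡.trans (≡.cong (ℕ._+ ℕ.suc (toℕ x)) (Fin.opposite-prop x)) (ℕP.m∸n+n≡m (Fin.toℕ<n x))

  Neg-opposite : ∀ {x} → Neg x → ¬ Neg (opposite x)
  Neg-opposite {x} x<N ox<N = ℕP.<-irrefl (opposite-toℕ x) (ℕP.+-mono-≤ ox<N x<N)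

  ¬Neg-opposite : ∀ {x} → ¬ Neg x → Neg (opposite x)
  ¬Neg-opposite {x} x≮N = ℕP.≰⇒> λ N≤ox → x≮N (ℕP.+-cancelˡ-≤ N (ℕ.suc (toℕ x)) N
    (ℕP.≤-trans (ℕP.+-monoˡ-≤ (ℕ.suc (toℕ x)) N≤ox) (ℕP.≤-reflexive (opposite-toℕ x))))

  opposite-≢ : (x : Fin d) → opposite x ≢ x
  opposite-≢ x ox≡x with toℕ x ℕP.<? N
  ... | yes x<N = Neg-opposite x<N (≡.subst Neg (≡.sym ox≡x) x<N)
  ... | no x≮N = x≮N (≡.subst Neg ox≡x (¬Neg-opposite x≮N))

  J-off : ∀ {x y} → y ≢ opposite x → J x y ≈ 0#
  J-off {x} {y} y≢ox with y Fin.≟ opposite x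
  ... | yes y≡ox = ⊥-elim (y≢ox y≡ox)
  ... | no _     = refl

  J-opposite-Neg : ∀ {x} → Neg x → J x (opposite x) ≈ 1#
  J-opposite-Neg {x} x<N with opposite x Fin.≟ opposite x | toℕ x ℕP.<? N
  ... | yes _ | yes _    = refl
  ... | yes _ | no x≮N   = ⊥-elim (x≮N x<N)
  ... | no ox≢ox | _     = ⊥-elim (ox≢ox ≡.refl)

  J-opposite-¬Neg : ∀ {x} → ¬ Neg x → J x (opposite x) ≈ - 1#
  J-opposite-¬Neg {x} x≮N with opposite x Fin.≟ opposite x | toℕ x ℕP.<? N
  ... | yes _ | yes x<N  = ⊥-elim (x≮N x<N)
  ... | yes _ | no _     = refl
  ... | no ox≢ox | _     = ⊥-elim (ox≢ox ≡.refl)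

  J-opposite² : (x : Fin d) → J x (opposite x) * J x (opposite x) ≈ 1#
  J-opposite² x = by-sign (toℕ x ℕP.<? N)
    where
    by-sign : Dec (Neg x) → J x (opposite x) * J x (opposite x) ≈ 1#
    by-sign (yes x<N) = trans (*-cong (J-opposite-Neg x<N) (J-opposite-Neg x<N)) (*-identityˡ 1#)
    by-sign (no x≮N)  = trans (*-cong (J-opposite-¬Neg x≮N) (J-opposite-¬Neg x≮N))
                              (trans (-1*x≈-x (- 1#)) (-‿involutive 1#))

  J-opposite-antisymmetric : (x : Fin d) → J (opposite x) x ≈ - J x (opposite x)
  J-opposite-antisymmetric x = ≡.subst (λ z → J (opposite x) z ≈ - J x (opposite x)) (Fin.opposite-involutive x)
                                       (by-sign (toℕ x ℕP.<? N))
    where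
    by-sign : Dec (Neg x) → J (opposite x) (opposite (opposite x)) ≈ - J x (opposite x)
    by-sign (yes x<N) = trans (J-opposite-¬Neg (Neg-opposite x<N)) (-‿cong (sym (J-opposite-Neg x<N)))
    by-sign (no x≮N)  = trans (J-opposite-Neg (¬Neg-opposite x≮N))
                              (trans (sym (-‿involutive 1#)) (-‿cong (sym (J-opposite-¬Neg x≮N))))

  J-antisymmetric : (x y : Fin d) → J y x ≈ - J x y
  J-antisymmetric x y = by-cases (y Fin.≟ opposite x)
    where
    by-cases : Dec (y ≡ opposite x) → J y x ≈ - J x y
    by-cases (yes y≡ox) = ≡.subst (λ z → J z x ≈ - J x z) (≡.sym y≡ox) (J-opposite-antisymmetric x)
    by-cases (no y≢ox)  = trans (J-off (λ x≡oy → y≢ox (≡.trans (≡.sym (Fin.opposite-involutive y)) (≡.cong opposite (≡.sym x≡oy)))))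
                                (trans (sym -0#≈0#) (-‿cong (sym (J-off y≢ox))))

  Inner-opposite : ∀ {x} → Inner x → Inner (opposite x)
  Inner-opposite {x} (n≤x , x<n+2m) = n≤ox , ox<n+2m
    where
    open +-*-Solver using (solve; _:+_; _:=_)
    d≡n+[n+2m] : d ≡ n ℕ.+ (n ℕ.+ (m ℕ.+ m))
    d≡n+[n+2m] = solve 2 (λ m n → (m :+ n) :+ (m :+ n) := n :+ (n :+ (m :+ m))) ≡.refl m n
    d≡[n+2m]+n : d ≡ (n ℕ.+ (m ℕ.+ m)) ℕ.+ n
    d≡[n+2m]+n = solve 2 (λ m n → (m :+ n) :+ (m :+ n) := (n :+ (m :+ m)) :+ n) ≡.refl m n
    n≤ox : n ℕ.≤ toℕ (opposite x)
    n≤ox = ℕP.≮⇒≥ λ ox<n → ℕP.n≮n d (≡.subst₂ ℕ._≤_ (≡.cong ℕ.suc (opposite-toℕ x)) (≡.sym d≡n+[n+2m])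
                                      (ℕP.+-mono-≤ ox<n x<n+2m))
    ox<n+2m : toℕ (opposite x) ℕ.< n ℕ.+ (m ℕ.+ m)
    ox<n+2m = ℕP.+-cancelʳ-≤ n (ℕ.suc (toℕ (opposite x))) (n ℕ.+ (m ℕ.+ m))
      (≡.subst (ℕ.suc (toℕ (opposite x)) ℕ.+ n ℕ.≤_) (≡.trans (≡.sym (ℕP.+-suc _ _)) (≡.trans (opposite-toℕ x) d≡[n+2m]+n))
        (ℕP.+-monoʳ-≤ (ℕ.suc (toℕ (opposite x))) n≤x))

  Inner? : ∀ x → Dec (Inner x)
  Inner? x = (n ℕP.≤? toℕ x) ×-dec (toℕ x ℕP.<? n ℕ.+ (m ℕ.+ m))

  inner : Fin d → Bool
  inner x = does (Inner? x)

  inner-opposite : ∀ x → inner (opposite x) ≡ inner x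
  inner-opposite x = does-⇔ (mk⇔ (λ ox∈ → ≡.subst Inner (Fin.opposite-involutive x) (Inner-opposite ox∈)) Inner-opposite)
                            (Inner? (opposite x)) (Inner? x)

  module Adapted (g : Mat d) (D : Decomposition g)
                 (symmetric : ∀ e → edges D e ⇔ edges D (neg e))
                 (horizontal-free : ∀ e → edges D e → ¬ Horizontal e) where
    open Decomposition D

    private
      o : Fin d → Fin d
      o = opposite

    role-A-opposite : ∀ {x} → role x ≡ kindA → role (o x) ≡ kindA
    role-A-opposite {x} = Equivalence.to (symmetric (vw x))

    role-C-opposite : ∀ {x y} → role x ≡ kindC y → role (o x) ≡ kindC (o y)
    role-C-opposite {x} {y} = Equivalence.to (symmetric (vv x y))

    role-B-opposite : ∀ {x} → role x ≡ kindB → role (o x) ≡ kindB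
    role-B-opposite {x} x∈B with role (o x) in ox-role
    ... | kindB = ≡.refl
    ... | kindA with ≡.trans (≡.sym x∈B) (≡.subst (λ z → role z ≡ kindA) (Fin.opposite-involutive x) (role-A-opposite ox-role))
    ...   | ()
    role-B-opposite {x} x∈B | kindC y with ≡.trans (≡.sym x∈B) (≡.subst (λ z → role z ≡ _) (Fin.opposite-involutive x) (role-C-opposite ox-role))
    ...   | ()

    mate-of : Fin d → Role → Fin d
    mate-of x (kindC y) = y
    mate-of x _         = x

    mate : Fin d → Fin d
    mate x = mate-of x (role x)

    mate-C : ∀ {x y} → role x ≡ kindC y → mate x ≡ y
    mate-C x∈C rewrite x∈C = ≡.refl

    mate-A : ∀ {x} → role x ≡ kindA → mate x ≡ x
    mate-A x∈A rewrite x∈A = ≡.refl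

    mate-B : ∀ {x} → role x ≡ kindB → mate x ≡ x
    mate-B x∈B rewrite x∈B = ≡.refl

    mate-involutive : ∀ x → mate (mate x) ≡ x
    mate-involutive x with role x in x-role
    ... | kindA   = mate-A x-role
    ... | kindB   = mate-B x-role
    ... | kindC y = mate-C (partner x y x-role)

    mate-opposite : ∀ x → mate (o x) ≡ o (mate x)
    mate-opposite x with role x in x-role
    ... | kindA   = mate-A (role-A-opposite x-role)
    ... | kindB   = mate-B (role-B-opposite x-role)
    ... | kindC y = mate-C (role-C-opposite x-role)

    dual : Fin d → Fin d
    dual x = o (mate x)

    dual-involutive : ∀ x → dual (dual x) ≡ x
    dual-involutive x = ≡.trans (≡.cong o (mate-opposite (mate x)))
      (≡.trans (Fin.opposite-involutive (mate (mate x))) (mate-involutive x))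

    opposite-< : ∀ {x y : Fin d} → x <ᶠ y → o y <ᶠ o x
    opposite-< {x} {y} x<y = ≡.subst₂ ℕ._<_ (≡.sym (Fin.opposite-prop y)) (≡.sym (Fin.opposite-prop x))
                                     (ℕP.∸-monoʳ-< (ℕ.s≤s x<y) (Fin.toℕ<n y))

    data Corner : Set where
      q-corner p-corner p̄-corner q̄-corner : Corner

    data Place : Set where
      solo : Place
      in-quad : Corner → Place

    place-of : Fin d → Role → Place
    place-of x kindA     = solo
    place-of x kindB     = solo
    place-of x (kindC y) =
      if does (x Fin.<? y) then (if does (o y Fin.<? x) then in-quad p̄-corner else in-quad q-corner)
                           else (if does (o x Fin.<? y) then in-quad q̄-corner else in-quad p-corner)

    place : Fin d → Place
    place x = place-of x (role x)

    -- a kind-(c) summand {q, p} with its mirror image {q̄, p̄}, labelled so that q is the least of the four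
    record Quad : Set where
      field
        q p : Fin d
        q↔p : role q ≡ kindC p
        q<p : q <ᶠ p
        q<p̄ : q <ᶠ o p

      p̄ q̄ : Fin d
      p̄ = o p
      q̄ = o q

      p↔q : role p ≡ kindC q
      p↔q = partner q p q↔p

      p̄↔q̄ : role p̄ ≡ kindC q̄
      p̄↔q̄ = role-C-opposite p↔q

      q̄↔p̄ : role q̄ ≡ kindC p̄
      q̄↔p̄ = role-C-opposite q↔p

      p̄<q̄ : p̄ <ᶠ q̄
      p̄<q̄ = opposite-< q<p

      o-q̄<p̄ : o q̄ <ᶠ p̄
      o-q̄<p̄ = ≡.subst (_<ᶠ p̄) (≡.sym (Fin.opposite-involutive q)) q<p̄

      place-q : place q ≡ in-quad q-corner
      place-q rewrite q↔p | dec-true (q Fin.<? p) q<p | dec-false (o p Fin.<? q) (ℕP.<-asym q<p̄) = ≡.refl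

      place-p : place p ≡ in-quad p-corner
      place-p rewrite p↔q | dec-false (p Fin.<? q) (ℕP.<-asym q<p) | dec-false (o p Fin.<? q) (ℕP.<-asym q<p̄) = ≡.refl

      place-p̄ : place p̄ ≡ in-quad p̄-corner
      place-p̄ rewrite p̄↔q̄ | dec-true (p̄ Fin.<? q̄) p̄<q̄ | dec-true (o q̄ Fin.<? p̄) o-q̄<p̄ = ≡.refl

      place-q̄ : place q̄ ≡ in-quad q̄-corner
      place-q̄ rewrite q̄↔p̄ | dec-false (q̄ Fin.<? p̄) (ℕP.<-asym p̄<q̄) | dec-true (o q̄ Fin.<? p̄) o-q̄<p̄ = ≡.refl

      mate-q : mate q ≡ p
      mate-q = mate-C q↔p

      mate-p : mate p ≡ q
      mate-p = mate-C p↔q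

      mate-p̄ : mate p̄ ≡ q̄
      mate-p̄ = mate-C p̄↔q̄

      mate-q̄ : mate q̄ ≡ p̄
      mate-q̄ = mate-C q̄↔p̄

      q<mate-q : q <ᶠ mate q
      q<mate-q = ≡.subst (q <ᶠ_) (≡.sym mate-q) q<p

      p≮mate-p : ¬ p <ᶠ mate p
      p≮mate-p p<mp = ℕP.<-asym q<p (≡.subst (p <ᶠ_) mate-p p<mp)

      p̄<mate-p̄ : p̄ <ᶠ mate p̄
      p̄<mate-p̄ = ≡.subst (p̄ <ᶠ_) (≡.sym mate-p̄) p̄<q̄

      q̄≮mate-q̄ : ¬ q̄ <ᶠ mate q̄
      q̄≮mate-q̄ q̄<mq̄ = ℕP.<-asym p̄<q̄ (≡.subst (q̄ <ᶠ_) mate-q̄ q̄<mq̄)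

      place-mate-q : place (mate q) ≡ in-quad p-corner
      place-mate-q = ≡.trans (≡.cong place mate-q) place-p

      place-mate-p̄ : place (mate p̄) ≡ in-quad q̄-corner
      place-mate-p̄ = ≡.trans (≡.cong place mate-p̄) place-q̄

      place-mate-q̄ : place (mate q̄) ≡ in-quad p̄-corner
      place-mate-q̄ = ≡.trans (≡.cong place mate-q̄) place-p̄

    corner : Quad → Corner → Fin d
    corner Q q-corner  = Quad.q Q
    corner Q p-corner  = Quad.p Q
    corner Q p̄-corner = o (Quad.p Q)
    corner Q q̄-corner = o (Quad.q Q)

    data View : Fin d → Set where
      solo : ∀ {x} → role x ≡ kindA ⊎ role x ≡ kindB → View x
      quad : (Q : Quad) (κ : Corner) → View (corner Q κ)

    view : ∀ x → View x
    view x with role x in x-role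
    ... | kindA   = solo (inj₁ x-role)
    ... | kindB   = solo (inj₂ x-role)
    ... | kindC y with x Fin.<? y
    ...   | yes x<y with o y Fin.<? x
    ...     | yes oy<x = ≡.subst View (Fin.opposite-involutive x) (quad record
              { q = o y ; p = o x ; q↔p = role-C-opposite (partner x y x-role) ; q<p = opposite-< x<y
              ; q<p̄ = ≡.subst (o y <ᶠ_) (≡.sym (Fin.opposite-involutive x)) oy<x } p̄-corner)
    ...     | no oy≮x = quad record
              { q = x ; p = y ; q↔p = x-role ; q<p = x<y
              ; q<p̄ = Fin.≤∧≢⇒< (ℕP.≮⇒≥ oy≮x) (λ x≡oy → horizontal-free (vv x y) x-role
                        (≡.trans (≡.sym (Fin.opposite-involutive y)) (≡.cong o (≡.sym x≡oy)))) } q-corner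
    view x | kindC y | no x≮y with o x Fin.<? y
    ...     | yes ox<y = ≡.subst View (Fin.opposite-involutive x) (quad record
              { q = o x ; p = o y ; q↔p = role-C-opposite x-role ; q<p = opposite-< y<x
              ; q<p̄ = ≡.subst (o x <ᶠ_) (≡.sym (Fin.opposite-involutive y)) ox<y } q̄-corner)
      where
      y<x : y <ᶠ x
      y<x = Fin.≤∧≢⇒< (ℕP.≮⇒≥ x≮y) (λ y≡x → distinct x y x-role (≡.sym y≡x))
    ...     | no ox≮y = quad record
              { q = y ; p = x ; q↔p = partner x y x-role ; q<p = y<x
              ; q<p̄ = Fin.≤∧≢⇒< (ℕP.≮⇒≥ ox≮y) (horizontal-free (vv x y) x-role) } p-corner
      where
      y<x : y <ᶠ x
      y<x = Fin.≤∧≢⇒< (ℕP.≮⇒≥ x≮y) (λ y≡x → distinct x y x-role (≡.sym y≡x))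

    solo-place : ∀ {x} → role x ≡ kindA ⊎ role x ≡ kindB → place x ≡ solo
    solo-place (inj₁ x∈A) rewrite x∈A = ≡.refl
    solo-place (inj₂ x∈B) rewrite x∈B = ≡.refl

    solo-mate : ∀ {x} → role x ≡ kindA ⊎ role x ≡ kindB → mate x ≡ x
    solo-mate (inj₁ x∈A) = mate-A x∈A
    solo-mate (inj₂ x∈B) = mate-B x∈B

    by-place : ∀ {a} {A : Set a} (F : Place → Fin d → A) {y π} → place y ≡ π → F (place y) y ≡ F π y
    by-place F {y} = ≡.cong (λ π → F π y)

    -- at the corner q this is −J(p, p̄) J(q, q̄), which makes f q orthogonal to f q̄
    scale : Fin d → Carrier
    scale x = - (J (mate x) (o (mate x)) * J x (o x))

    t-column : Place → Fin d → Vec d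
    t-column solo                 x = e x
    t-column (in-quad q-corner)  x = scale x ⋆ e x
    t-column (in-quad p-corner)  x = e x
    t-column (in-quad p̄-corner) x = (- 1#) ⋆ e x
    t-column (in-quad q̄-corner) x = e x +ᵥ e (mate x)

    t : Mat d
    t z x = t-column (place x) x z

    e-below : ∀ {x z : Fin d} → x <ᶠ z → e x z ≈ 0#
    e-below x<z = idM-off (λ z≡x → Fin.<-irrefl (≡.sym z≡x) x<z)

    t-upper : UpperTriangular t
    t-upper z x x<z with view x
    ... | solo s rewrite solo-place s = e-below x<z
    ... | quad Q q-corner  rewrite Quad.place-q Q  = trans (*-congˡ (e-below x<z)) (zeroʳ _)
    ... | quad Q p-corner  rewrite Quad.place-p Q  = e-below x<z
    ... | quad Q p̄-corner rewrite Quad.place-p̄ Q = trans (*-congˡ (e-below x<z)) (zeroʳ _)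
    ... | quad Q q̄-corner rewrite Quad.place-q̄ Q | Quad.mate-q̄ Q =
      trans (+-cong (e-below x<z) (e-below (ℕP.<-trans (Quad.p̄<q̄ Q) x<z))) (+-identityʳ 0#)

    scale² : ∀ x → scale x * scale x ≈ 1#
    scale² x = trans (-x*-x (J (mate x) (o (mate x)) * J x (o x)))
      (trans (interchange _ _ _ _) (trans (*-cong (J-opposite² (mate x)) (J-opposite² x)) (*-identityˡ 1#)))

    t-fixes : ∀ {x} → col t x ≡ e x → t ·ᵥ col t x ≈V e x
    t-fixes {x} col≡e = begin
      t ·ᵥ col t x ≡⟨ ≡.cong (t ·ᵥ_) col≡e ⟩
      t ·ᵥ e x     ≈⟨ ·ᵥ-e t x ⟩
      col t x      ≡⟨ col≡e ⟩
      e x          ∎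
      where open VecReasoning

    t-rescales : ∀ {x} a → a * a ≈ 1# → col t x ≡ a ⋆ e x → t ·ᵥ col t x ≈V e x
    t-rescales {x} a a²≈1 col≡ae = begin
      t ·ᵥ col t x      ≡⟨ ≡.cong (t ·ᵥ_) col≡ae ⟩
      t ·ᵥ (a ⋆ e x)    ≈⟨ ·ᵥ-⋆ t a (e x) ⟩
      a ⋆ t ·ᵥ e x      ≈⟨ ⋆-congʳ a (·ᵥ-e t x) ⟩
      a ⋆ col t x       ≡⟨ ≡.cong (a ⋆_) col≡ae ⟩
      a ⋆ a ⋆ e x       ≈⟨ ⋆-⋆ a a (e x) ⟩
      (a * a) ⋆ e x     ≈⟨ ⋆-cong a²≈1 (e x) ⟩
      1# ⋆ e x          ≈⟨ 1⋆ (e x) ⟩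
      e x               ∎
      where open VecReasoning

    t-involutive : ∀ x → t ·ᵥ col t x ≈V e x
    t-involutive x with view x
    ... | solo s           = t-fixes (by-place t-column (solo-place s))
    ... | quad Q q-corner  = t-rescales (scale x) (scale² x) (by-place t-column (Quad.place-q Q))
    ... | quad Q p-corner  = t-fixes (by-place t-column (Quad.place-p Q))
    ... | quad Q p̄-corner = t-rescales (- 1#) -1*-1 (by-place t-column (Quad.place-p̄ Q))
    ... | quad Q q̄-corner = begin
      t ·ᵥ col t q̄                        ≡⟨ ≡.cong (t ·ᵥ_) (by-place t-column place-q̄) ⟩
      t ·ᵥ (e q̄ +ᵥ e (mate q̄))            ≈⟨ ·ᵥ-e+e t q̄ (mate q̄) ⟩
      col t q̄ +ᵥ col t (mate q̄)          ≡⟨ ≡.cong₂ _+ᵥ_ (by-place t-column place-q̄) (by-place t-column place-mate-q̄) ⟩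
      e q̄ +ᵥ e (mate q̄) +ᵥ (- 1#) ⋆ e (mate q̄)  ≈⟨ cancel (e q̄) (e (mate q̄)) ⟩
      e q̄                                 ∎
      where
      open VecReasoning
      open Quad Q

    Lower : Fin d → Set
    Lower x = x <ᶠ mate x

    Lower-mate : ∀ {x} → Lower x → ¬ Lower (mate x)
    Lower-mate {x} x<mx mx<mmx = ℕP.<-asym x<mx (≡.subst (mate x <ᶠ_) (mate-involutive x) mx<mmx)

    -- the generators of A and A′, summand by summand, in the basis u = h e (cf. wvec)
    w-of w⁻-of : (x : Fin d) → Dec (Lower x) → Vec d
    w-of x (yes _) = e x +ᵥ e (mate x)
    w-of x (no _)  = e x
    w⁻-of x (yes _) = e x +ᵥ (- 1#) ⋆ e (mate x)
    w⁻-of x (no _)  = e x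

    w w⁻ : Fin d → Vec d
    w x = w-of x (x Fin.<? mate x)
    w⁻ x = w⁻-of x (x Fin.<? mate x)

    W W⁻ : Mat d
    W z x = w x z
    W⁻ z x = w⁻ x z

    w-lower : ∀ {x} → Lower x → w x ≡ e x +ᵥ e (mate x)
    w-lower {x} x<mx with x Fin.<? mate x
    ... | yes _    = ≡.refl
    ... | no x≮mx = ⊥-elim (x≮mx x<mx)

    w-upper : ∀ {x} → ¬ Lower x → w x ≡ e x
    w-upper {x} x≮mx with x Fin.<? mate x
    ... | yes x<mx = ⊥-elim (x≮mx x<mx)
    ... | no _     = ≡.refl

    w⁻-lower : ∀ {x} → Lower x → w⁻ x ≡ e x +ᵥ (- 1#) ⋆ e (mate x)
    w⁻-lower {x} x<mx with x Fin.<? mate x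
    ... | yes _    = ≡.refl
    ... | no x≮mx = ⊥-elim (x≮mx x<mx)

    w⁻-upper : ∀ {x} → ¬ Lower x → w⁻ x ≡ e x
    w⁻-upper {x} x≮mx with x Fin.<? mate x
    ... | yes x<mx = ⊥-elim (x≮mx x<mx)
    ... | no _     = ≡.refl

    W·W⁻ : (W · W⁻) ≈M idM
    W·W⁻ z x = by-cases (x Fin.<? mate x) z
      where
      open VecReasoning
      by-cases : Dec (Lower x) → W ·ᵥ col W⁻ x ≈V e x
      by-cases (yes x<mx) = begin
        W ·ᵥ w⁻ x                                ≡⟨ ≡.cong (W ·ᵥ_) (w⁻-lower x<mx) ⟩
        W ·ᵥ (e x +ᵥ (- 1#) ⋆ e (mate x))        ≈⟨ ·ᵥ-e+⋆e W x (- 1#) (mate x) ⟩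
        w x +ᵥ (- 1#) ⋆ w (mate x)               ≡⟨ ≡.cong₂ (λ u v → u +ᵥ (- 1#) ⋆ v) (w-lower x<mx) (w-upper (Lower-mate x<mx)) ⟩
        e x +ᵥ e (mate x) +ᵥ (- 1#) ⋆ e (mate x) ≈⟨ cancel (e x) (e (mate x)) ⟩
        e x                                      ∎
      by-cases (no x≮mx) = begin
        W ·ᵥ w⁻ x  ≡⟨ ≡.cong (W ·ᵥ_) (w⁻-upper x≮mx) ⟩
        W ·ᵥ e x   ≈⟨ ·ᵥ-e W x ⟩
        w x        ≡⟨ w-upper x≮mx ⟩
        e x        ∎

    W⁻·W : (W⁻ · W) ≈M idM
    W⁻·W z x = by-cases (x Fin.<? mate x) z
      where
      open VecReasoning
      by-cases : Dec (Lower x) → W⁻ ·ᵥ col W x ≈V e x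
      by-cases (yes x<mx) = begin
        W⁻ ·ᵥ w x                                ≡⟨ ≡.cong (W⁻ ·ᵥ_) (w-lower x<mx) ⟩
        W⁻ ·ᵥ (e x +ᵥ e (mate x))                ≈⟨ ·ᵥ-e+e W⁻ x (mate x) ⟩
        w⁻ x +ᵥ w⁻ (mate x)                      ≡⟨ ≡.cong₂ _+ᵥ_ (w⁻-lower x<mx) (w⁻-upper (Lower-mate x<mx)) ⟩
        e x +ᵥ (- 1#) ⋆ e (mate x) +ᵥ e (mate x) ≈⟨ (λ z → trans (+-assoc _ _ _) (trans (+-congˡ (trans (+-congʳ (-1*x≈-x _)) (-‿inverseˡ _))) (+-identityʳ _))) ⟩
        e x                                      ∎
      by-cases (no x≮mx) = begin
        W⁻ ·ᵥ w x  ≡⟨ ≡.cong (W⁻ ·ᵥ_) (w-upper x≮mx) ⟩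
        W⁻ ·ᵥ e x  ≈⟨ ·ᵥ-e W⁻ x ⟩
        w⁻ x       ≡⟨ w⁻-upper x≮mx ⟩
        e x        ∎

    W-invertible : Invertible W
    W-invertible = W⁻ , W·W⁻ , W⁻·W

    f-column : Place → Fin d → Vec d
    f-column solo                 x = e x
    f-column (in-quad q-corner)  x = scale x ⋆ e x +ᵥ e (mate x)
    f-column (in-quad p-corner)  x = e x
    f-column (in-quad p̄-corner) x = e (mate x)
    f-column (in-quad q̄-corner) x = e x +ᵥ e (mate x)

    f : Fin d → Vec d
    f x = f-column (place x) x

    t-w-upper : ∀ {x} → ¬ Lower x → col t x ≡ f x → t ·ᵥ w x ≈V f x
    t-w-upper {x} x≮mx col≡f = begin
      t ·ᵥ w x   ≡⟨ ≡.cong (t ·ᵥ_) (w-upper x≮mx) ⟩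
      t ·ᵥ e x   ≈⟨ ·ᵥ-e t x ⟩
      col t x    ≡⟨ col≡f ⟩
      f x        ∎
      where open VecReasoning

    t-w : ∀ x → t ·ᵥ w x ≈V f x
    t-w x with view x
    ... | solo s = t-w-upper (Fin.<-irrefl (≡.sym (solo-mate s)))
                             (≡.trans (by-place t-column (solo-place s)) (≡.sym (by-place f-column (solo-place s))))
    ... | quad Q p-corner  = t-w-upper p≮mate-p (≡.trans (by-place t-column place-p) (≡.sym (by-place f-column place-p)))
      where open Quad Q
    ... | quad Q q̄-corner = t-w-upper q̄≮mate-q̄ (≡.trans (by-place t-column place-q̄) (≡.sym (by-place f-column place-q̄)))
      where open Quad Q
    ... | quad Q q-corner = begin
      t ·ᵥ w q                          ≡⟨ ≡.cong (t ·ᵥ_) (w-lower q<mate-q) ⟩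
      t ·ᵥ (e q +ᵥ e (mate q))          ≈⟨ ·ᵥ-e+e t q (mate q) ⟩
      col t q +ᵥ col t (mate q)         ≡⟨ ≡.cong₂ _+ᵥ_ (by-place t-column place-q) (by-place t-column place-mate-q) ⟩
      scale q ⋆ e q +ᵥ e (mate q)       ≡⟨ by-place f-column place-q ⟨
      f q                               ∎
      where open VecReasoning
            open Quad Q
    ... | quad Q p̄-corner = begin
      t ·ᵥ w p̄                                       ≡⟨ ≡.cong (t ·ᵥ_) (w-lower p̄<mate-p̄) ⟩
      t ·ᵥ (e p̄ +ᵥ e (mate p̄))                       ≈⟨ ·ᵥ-e+e t p̄ (mate p̄) ⟩
      col t p̄ +ᵥ col t (mate p̄)                     ≡⟨ ≡.cong₂ _+ᵥ_ (by-place t-column place-p̄) (by-place t-column place-mate-p̄) ⟩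
      (- 1#) ⋆ e p̄ +ᵥ (e (mate p̄) +ᵥ e (mate (mate p̄))) ≡⟨ ≡.cong (λ y → (- 1#) ⋆ e p̄ +ᵥ (e (mate p̄) +ᵥ e y)) (mate-involutive p̄) ⟩
      (- 1#) ⋆ e p̄ +ᵥ (e (mate p̄) +ᵥ e p̄)           ≈⟨ cancelˡ (e (mate p̄)) (e p̄) ⟩
      e (mate p̄)                                     ≡⟨ by-place f-column place-p̄ ⟨
      f p̄                                            ∎
      where open VecReasoning
            open Quad Q

    f-support : ∀ x i → i ≢ x → i ≢ mate x → f x i ≈ 0#
    f-support x i i≢x i≢mx with view x
    ... | solo s rewrite solo-place s = idM-off i≢x
    ... | quad Q q-corner  rewrite Quad.place-q Q  = trans (+-cong (trans (*-congˡ (idM-off i≢x)) (zeroʳ _)) (idM-off i≢mx)) (+-identityʳ 0#)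
    ... | quad Q p-corner  rewrite Quad.place-p Q  = idM-off i≢x
    ... | quad Q p̄-corner rewrite Quad.place-p̄ Q = idM-off i≢mx
    ... | quad Q q̄-corner rewrite Quad.place-q̄ Q = trans (+-cong (idM-off i≢x) (idM-off i≢mx)) (+-identityʳ 0#)

    G : Fin d → Fin d → Carrier
    G x y = form J (f x) (f y)

    G-antisymmetric : ∀ x y → G x y ≈ - G y x
    G-antisymmetric x y = form-antisymmetric J J-antisymmetric (f x) (f y)

    -- f x lives on {x, mate x}, and J i l = 0 unless l = o i.
    G-off : ∀ {x y} → y ≢ o x → y ≢ dual x → G x y ≈ 0#
    G-off {x} {y} y≢ox y≢dx = form-zero J (f x) (f y) term
      where
      left : ∀ {i l} → f x i ≈ 0# → f x i * J i l * f y l ≈ 0#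
      left fxi≈0 = trans (*-congʳ (trans (*-congʳ fxi≈0) (zeroˡ _))) (zeroˡ _)
      right : ∀ {i l} → f y l ≈ 0# → f x i * J i l * f y l ≈ 0#
      right fyl≈0 = trans (*-congˡ fyl≈0) (zeroʳ _)
      y≡mate : ∀ {l} → l ≡ mate y → y ≡ mate l
      y≡mate l≡my = ≡.trans (≡.sym (mate-involutive y)) (≡.cong mate (≡.sym l≡my))
      term : ∀ i l → f x i * J i l * f y l ≈ 0#
      term i l = by-J (l Fin.≟ o i)
        where
        by-J : Dec (l ≡ o i) → f x i * J i l * f y l ≈ 0#
        by-J (no l≢oi) = trans (*-congʳ (trans (*-congˡ (J-off l≢oi)) (zeroʳ _))) (zeroˡ _)
        by-J (yes l≡oi) = by-i (i Fin.≟ x) (i Fin.≟ mate x)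
          where
          by-i : Dec (i ≡ x) → Dec (i ≡ mate x) → f x i * J i l * f y l ≈ 0#
          by-i (yes i≡x) _ = right (f-support y l
            (λ l≡y → y≢ox (≡.trans (≡.sym l≡y) (≡.trans l≡oi (≡.cong o i≡x))))
            (λ l≡my → y≢dx (≡.trans (y≡mate l≡my) (≡.trans (≡.cong mate (≡.trans l≡oi (≡.cong o i≡x))) (mate-opposite x)))))
          by-i (no _) (yes i≡mx) = right (f-support y l
            (λ l≡y → y≢dx (≡.trans (≡.sym l≡y) (≡.trans l≡oi (≡.cong o i≡mx))))
            (λ l≡my → y≢ox (≡.trans (y≡mate l≡my) (≡.trans (≡.cong mate (≡.trans l≡oi (≡.cong o i≡mx)))
                                 (≡.trans (mate-opposite (mate x)) (≡.cong o (mate-involutive x)))))))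
          by-i (no i≢x) (no i≢mx) = left (f-support x i i≢x i≢mx)

    pairing : Fin d → Carrier
    pairing x = G x (dual x)

    pairing-dual : ∀ x → pairing (dual x) ≈ - pairing x
    pairing-dual x = trans (reflexive (≡.cong (G (dual x)) (dual-involutive x))) (G-antisymmetric (dual x) x)

    InA? : ∀ x → Dec (InA role x)
    InA? x with role x
    ... | kindA   = yes tt
    ... | kindB   = no (λ ())
    ... | kindC y = y Fin.<? x

    inA : Fin d → Bool
    inA x = does (InA? x)

    ¬InA⇒InA' : ∀ {x} → ¬ InA role x → InA' role x
    ¬InA⇒InA' {x} x∉A with role x in x-role
    ... | kindA   = ⊥-elim (x∉A tt)
    ... | kindB   = tt
    ... | kindC y = Fin.≤∧≢⇒< (ℕP.≮⇒≥ x∉A) (distinct x y x-role)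

    inA-false : ∀ {x} → inA x ≡ false → InA' role x
    inA-false {x} x∉A = ¬InA⇒InA' (λ x∈A → true≢false (≡.trans (≡.sym (dec-true (InA? x) x∈A)) x∉A))

    inA-true : ∀ {x} → inA x ≡ true → InA role x
    inA-true {x} = does-true (InA? x)

    InA-C : ∀ {x y} → role x ≡ kindC y → InA role x ≡ (y <ᶠ x)
    InA-C x↔y rewrite x↔y = ≡.refl

    inA-C : ∀ {x y} → role x ≡ kindC y → inA x ≡ does (y Fin.<? x)
    inA-C x↔y rewrite x↔y = ≡.refl

    inA-A : ∀ {x} → role x ≡ kindA → inA x ≡ true
    inA-A x∈A rewrite x∈A = ≡.refl

    inA-B : ∀ {x} → role x ≡ kindB → inA x ≡ false
    inA-B x∈B rewrite x∈B = ≡.refl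

    τ-of : Place → Fin d → Fin d
    τ-of (in-quad p̄-corner) x = mate x
    τ-of (in-quad q̄-corner) x = mate x
    τ-of _                   x = x

    τ : Fin d → Fin d
    τ x = τ-of (place x) x

    module OnQuad (Q : Quad) where
      open Quad Q public
      open ≈-Reasoning

      σ s : Carrier
      σ = J p p̄
      s = J q q̄

      f-q : f q ≡ (- (σ * s)) ⋆ e q +ᵥ e p
      f-q = ≡.trans (by-place f-column place-q) (≡.cong (λ y → (- (J y (o y) * s)) ⋆ e q +ᵥ e y) mate-q)

      f-p : f p ≡ e p
      f-p = by-place f-column place-p

      f-p̄ : f p̄ ≡ e q̄
      f-p̄ = ≡.trans (by-place f-column place-p̄) (≡.cong e mate-p̄)

      f-q̄ : f q̄ ≡ e q̄ +ᵥ e p̄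
      f-q̄ = ≡.trans (by-place f-column place-q̄) (≡.cong (λ y → e q̄ +ᵥ e y) mate-q̄)

      J-p-q̄ : J p q̄ ≈ 0#
      J-p-q̄ = J-off (λ q̄≡p̄ → Fin.<-irrefl (≡.sym q̄≡p̄) p̄<q̄)

      J-q-p̄ : J q p̄ ≈ 0#
      J-q-p̄ = J-off (λ p̄≡q̄ → Fin.<-irrefl p̄≡q̄ p̄<q̄)

      G-q-p̄ : G q p̄ ≈ - σ
      G-q-p̄ = begin
        G q p̄                                       ≡⟨ ≡.cong₂ (form J) f-q f-p̄ ⟩
        form J ((- (σ * s)) ⋆ e q +ᵥ e p) (e q̄)     ≈⟨ form-+ˡ J _ (e p) (e q̄) ⟩
        form J ((- (σ * s)) ⋆ e q) (e q̄) + form J (e p) (e q̄) ≈⟨ +-cong (trans (form-⋆ˡ J _ (e q) (e q̄)) (*-congˡ (form-e J q q̄))) (form-e J p q̄) ⟩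
        - (σ * s) * s + J p q̄                       ≈⟨ +-cong (sym (-‿distribˡ-* (σ * s) s)) J-p-q̄ ⟩
        - (σ * s * s) + 0#                          ≈⟨ +-identityʳ _ ⟩
        - (σ * s * s)                               ≈⟨ -‿cong (trans (*-assoc σ s s) (trans (*-congˡ (J-opposite² q)) (*-identityʳ σ))) ⟩
        - σ                                         ∎

      G-p-q̄ : G p q̄ ≈ σ
      G-p-q̄ = begin
        G p q̄                              ≡⟨ ≡.cong₂ (form J) f-p f-q̄ ⟩
        form J (e p) (e q̄ +ᵥ e p̄)          ≈⟨ form-+ʳ J (e p) (e q̄) (e p̄) ⟩
        form J (e p) (e q̄) + form J (e p) (e p̄) ≈⟨ +-cong (form-e J p q̄) (form-e J p p̄) ⟩
        J p q̄ + σ                          ≈⟨ +-congʳ J-p-q̄ ⟩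
        0# + σ                             ≈⟨ +-identityˡ σ ⟩
        σ                                  ∎

      G-q-q̄ : G q q̄ ≈ 0#
      G-q-q̄ = begin
        G q q̄                                        ≡⟨ ≡.cong₂ (form J) f-q f-q̄ ⟩
        form J ((- (σ * s)) ⋆ e q +ᵥ e p) (e q̄ +ᵥ e p̄) ≈⟨ form-+ʳ J _ (e q̄) (e p̄) ⟩
        form J ((- (σ * s)) ⋆ e q +ᵥ e p) (e q̄) + form J ((- (σ * s)) ⋆ e q +ᵥ e p) (e p̄)
          ≈⟨ +-cong (trans (reflexive (≡.sym (≡.cong₂ (form J) f-q f-p̄))) G-q-p̄) second ⟩
        - σ + σ                                      ≈⟨ -‿inverseˡ σ ⟩
        0#                                           ∎
        where
        second : form J ((- (σ * s)) ⋆ e q +ᵥ e p) (e p̄) ≈ σ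
        second = begin
          form J ((- (σ * s)) ⋆ e q +ᵥ e p) (e p̄)                ≈⟨ form-+ˡ J _ (e p) (e p̄) ⟩
          form J ((- (σ * s)) ⋆ e q) (e p̄) + form J (e p) (e p̄) ≈⟨ +-cong (trans (form-⋆ˡ J _ (e q) (e p̄)) (*-congˡ (form-e J q p̄))) (form-e J p p̄) ⟩
          - (σ * s) * J q p̄ + σ                                 ≈⟨ +-congʳ (trans (*-congˡ J-q-p̄) (zeroʳ _)) ⟩
          0# + σ                                                ≈⟨ +-identityˡ σ ⟩
          σ                                                     ∎

      G-p-p̄ : G p p̄ ≈ 0#
      G-p-p̄ = trans (reflexive (≡.cong₂ (form J) f-p f-p̄)) (trans (form-e J p q̄) J-p-q̄)

      dual-q : dual q ≡ p̄
      dual-q = ≡.cong o mate-q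

      dual-p : dual p ≡ q̄
      dual-p = ≡.cong o mate-p

      dual-p̄ : dual p̄ ≡ q
      dual-p̄ = ≡.trans (≡.cong o mate-p̄) (Fin.opposite-involutive q)

      dual-q̄ : dual q̄ ≡ p
      dual-q̄ = ≡.trans (≡.cong o mate-q̄) (Fin.opposite-involutive p)

      pairing-q : pairing q ≈ - σ
      pairing-q = trans (reflexive (≡.cong (G q) dual-q)) G-q-p̄

      pairing-p : pairing p ≈ σ
      pairing-p = trans (reflexive (≡.cong (G p) dual-p)) G-p-q̄

      pairing-p̄ : pairing p̄ ≈ σ
      pairing-p̄ = trans (reflexive (≡.cong pairing (≡.sym dual-q)))
                    (trans (pairing-dual q) (trans (-‿cong pairing-q) (-‿involutive σ)))

      pairing-q̄ : pairing q̄ ≈ - σ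
      pairing-q̄ = trans (reflexive (≡.cong pairing (≡.sym dual-p))) (trans (pairing-dual p) (-‿cong pairing-p))

      inA-q : inA q ≡ false
      inA-q = ≡.trans (inA-C q↔p) (dec-false (p Fin.<? q) (ℕP.<-asym q<p))

      inA-p : inA p ≡ true
      inA-p = ≡.trans (inA-C p↔q) (dec-true (q Fin.<? p) q<p)

      inA-p̄ : inA p̄ ≡ false
      inA-p̄ = ≡.trans (inA-C p̄↔q̄) (dec-false (q̄ Fin.<? p̄) (ℕP.<-asym p̄<q̄))

      inA-q̄ : inA q̄ ≡ true
      inA-q̄ = ≡.trans (inA-C q̄↔p̄) (dec-true (p̄ Fin.<? q̄) p̄<q̄)

      τ-q : τ q ≡ q
      τ-q = by-place τ-of place-q

      τ-p : τ p ≡ p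
      τ-p = by-place τ-of place-p

      τ-p̄ : τ p̄ ≡ q̄
      τ-p̄ = ≡.trans (by-place τ-of place-p̄) mate-p̄

      τ-q̄ : τ q̄ ≡ p̄
      τ-q̄ = ≡.trans (by-place τ-of place-q̄) mate-q̄

    G-solo : ∀ {x} → role x ≡ kindA ⊎ role x ≡ kindB → G x (o x) ≈ J x (o x)
    G-solo {x} s = trans (reflexive (≡.cong₂ (form J) (by-place f-column (solo-place s)) (by-place f-column (solo-place s′))))
                         (form-e J x (o x))
      where
      s′ : role (o x) ≡ kindA ⊎ role (o x) ≡ kindB
      s′ = Data.Sum.map role-A-opposite role-B-opposite s

    pairing² : ∀ x → pairing x * pairing x ≈ 1#
    pairing² x with view x
    ... | solo s = trans (*-cong G≈J G≈J) (J-opposite² x)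
      where
      G≈J : pairing x ≈ J x (o x)
      G≈J = trans (reflexive (≡.cong (λ y → G x (o y)) (solo-mate s))) (G-solo s)
    ... | quad Q q-corner  = trans (*-cong pairing-q pairing-q) (-x*-x≈1 (J-opposite² p)) where open OnQuad Q
    ... | quad Q p-corner  = trans (*-cong pairing-p pairing-p) (J-opposite² p) where open OnQuad Q
    ... | quad Q p̄-corner = trans (*-cong pairing-p̄ pairing-p̄) (J-opposite² p) where open OnQuad Q
    ... | quad Q q̄-corner = trans (*-cong pairing-q̄ pairing-q̄) (-x*-x≈1 (J-opposite² p)) where open OnQuad Q

    G-opposite : ∀ x → mate x ≢ x → G x (o x) ≈ 0#
    G-opposite x mx≢x with view x
    ... | solo s = ⊥-elim (mx≢x (solo-mate s))
    ... | quad Q q-corner  = G-q-q̄ where open OnQuad Q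
    ... | quad Q p-corner  = G-p-p̄ where open OnQuad Q
    ... | quad Q p̄-corner = begin
      G p̄ (o p̄)  ≡⟨ ≡.cong (G p̄) (Fin.opposite-involutive p) ⟩
      G p̄ p      ≈⟨ G-antisymmetric p̄ p ⟩
      - G p p̄    ≈⟨ -‿cong G-p-p̄ ⟩
      - 0#       ≈⟨ -0#≈0# ⟩
      0#         ∎
      where open OnQuad Q
            open ≈-Reasoning
    ... | quad Q q̄-corner = begin
      G q̄ (o q̄)  ≡⟨ ≡.cong (G q̄) (Fin.opposite-involutive q) ⟩
      G q̄ q      ≈⟨ G-antisymmetric q̄ q ⟩
      - G q q̄    ≈⟨ -‿cong G-q-q̄ ⟩
      - 0#       ≈⟨ -0#≈0# ⟩
      0#         ∎
      where open OnQuad Q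
            open ≈-Reasoning

    G-zero : ∀ {x y} → y ≢ dual x → G x y ≈ 0#
    G-zero {x} {y} y≢dx = by-cases (y Fin.≟ o x)
      where
      by-cases : Dec (y ≡ o x) → G x y ≈ 0#
      by-cases (no y≢ox)  = G-off y≢ox y≢dx
      by-cases (yes y≡ox) = trans (reflexive (≡.cong (G x) y≡ox))
        (G-opposite x (λ mx≡x → y≢dx (≡.trans y≡ox (≡.cong o (≡.sym mx≡x)))))

    inA-dual : ∀ x → inA (dual x) ≡ inA x
    inA-dual x with view x
    ... | solo (inj₁ x∈A) = ≡.trans (≡.cong (inA ∘ o) (mate-A x∈A)) (≡.trans (inA-A (role-A-opposite x∈A)) (≡.sym (inA-A x∈A)))
    ... | solo (inj₂ x∈B) = ≡.trans (≡.cong (inA ∘ o) (mate-B x∈B)) (≡.trans (inA-B (role-B-opposite x∈B)) (≡.sym (inA-B x∈B)))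
    ... | quad Q q-corner  = ≡.trans (≡.cong inA (OnQuad.dual-q Q)) (≡.trans inA-p̄ (≡.sym inA-q)) where open OnQuad Q
    ... | quad Q p-corner  = ≡.trans (≡.cong inA (OnQuad.dual-p Q)) (≡.trans inA-q̄ (≡.sym inA-p)) where open OnQuad Q
    ... | quad Q p̄-corner = ≡.trans (≡.cong inA (OnQuad.dual-p̄ Q)) (≡.trans inA-q (≡.sym inA-p̄)) where open OnQuad Q
    ... | quad Q q̄-corner = ≡.trans (≡.cong inA (OnQuad.dual-q̄ Q)) (≡.trans inA-p (≡.sym inA-q̄)) where open OnQuad Q

    τ-solo : ∀ {x} → role x ≡ kindA ⊎ role x ≡ kindB → τ x ≡ x
    τ-solo s = by-place τ-of (solo-place s)

    τ-involutive : ∀ x → τ (τ x) ≡ x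
    τ-involutive x with view x
    ... | solo s = ≡.trans (≡.cong τ (τ-solo s)) (τ-solo s)
    ... | quad Q q-corner  = ≡.trans (≡.cong τ τ-q) τ-q where open OnQuad Q
    ... | quad Q p-corner  = ≡.trans (≡.cong τ τ-p) τ-p where open OnQuad Q
    ... | quad Q p̄-corner = ≡.trans (≡.cong τ τ-p̄) τ-q̄ where open OnQuad Q
    ... | quad Q q̄-corner = ≡.trans (≡.cong τ τ-q̄) τ-p̄ where open OnQuad Q

    τ-opposite : ∀ x → τ (o x) ≡ dual (τ x)
    τ-opposite x with view x
    ... | solo s = ≡.trans (τ-solo (Data.Sum.map role-A-opposite role-B-opposite s))
                           (≡.cong o (≡.trans (≡.sym (solo-mate s)) (≡.cong mate (≡.sym (τ-solo s)))))
    ... | quad Q q-corner  = ≡.trans τ-q̄ (≡.sym (≡.trans (≡.cong dual τ-q) (OnQuad.dual-q Q))) where open OnQuad Q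
    ... | quad Q p-corner  = ≡.trans τ-p̄ (≡.sym (≡.trans (≡.cong dual τ-p) (OnQuad.dual-p Q))) where open OnQuad Q
    ... | quad Q p̄-corner = ≡.trans (≡.cong τ (Fin.opposite-involutive p)) (≡.trans τ-p (≡.sym (≡.trans (≡.cong dual τ-p̄) (OnQuad.dual-q̄ Q))))
      where open OnQuad Q
    ... | quad Q q̄-corner = ≡.trans (≡.cong τ (Fin.opposite-involutive q)) (≡.trans τ-q (≡.sym (≡.trans (≡.cong dual τ-q̄) (OnQuad.dual-p̄ Q))))
      where open OnQuad Q

    InA⇒¬Lower : ∀ {x} → InA role x → ¬ Lower x
    InA⇒¬Lower {x} x∈A x<mx with role x
    ... | kindA   = Fin.<-irrefl ≡.refl x<mx
    ... | kindC y = ℕP.<-asym x∈A x<mx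

    h·w-upper : ∀ {x} → ¬ Lower x → h ·ᵥ w x ≈V col h x
    h·w-upper {x} x≮mx z = trans (·ᵥ-cong h (≈V-reflexive (w-upper x≮mx)) z) (·ᵥ-e h x z)

    h·w-lower : ∀ {x} → Lower x → h ·ᵥ w x ≈V col h x +ᵥ col h (mate x)
    h·w-lower {x} x<mx z = trans (·ᵥ-cong h (≈V-reflexive (w-lower x<mx)) z) (·ᵥ-e+e h x (mate x) z)

    wvec-B : ∀ {x} → role x ≡ kindB → wvec role h x ≡ col h x
    wvec-B x∈B rewrite x∈B = ≡.refl

    wvec-C : ∀ {x y} → role x ≡ kindC y → wvec role h x ≡ col h x +ᵥ col h y
    wvec-C x↔y rewrite x↔y = ≡.refl

    InA-A : ∀ {x} → role x ≡ kindA → InA role x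
    InA-A x∈A rewrite x∈A = tt

    h·w-A : ∀ {x} → InA role x → h ·ᵥ w x ≈V col h x
    h·w-A x∈A = h·w-upper (InA⇒¬Lower x∈A)

    h·w-A' : ∀ {x} → ¬ InA role x → h ·ᵥ w x ≈V wvec role h x
    h·w-A' {x} x∉A = by-role (role x) ≡.refl
      where
      by-role : ∀ r → role x ≡ r → h ·ᵥ w x ≈V wvec role h x
      by-role kindA     x∈A = ⊥-elim (x∉A (InA-A x∈A))
      by-role kindB     x∈B z = trans (h·w-upper (Fin.<-irrefl (≡.sym (mate-B x∈B))) z) (reflexive (≡.cong (λ v → v z) (≡.sym (wvec-B x∈B))))
      by-role (kindC y) x↔y z = trans (h·w-lower x<mx z)
        (trans (+-congˡ (reflexive (≡.cong (h z) (mate-C x↔y)))) (reflexive (≡.cong (λ v → v z) (≡.sym (wvec-C x↔y)))))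
        where
        x<mx : Lower x
        x<mx = ≡.subst (x <ᶠ_) (≡.sym (mate-C x↔y))
                 (Fin.≤∧≢⇒< (ℕP.≮⇒≥ (x∉A ∘ ≡.subst (λ A → A) (≡.sym (InA-C x↔y)))) (distinct x y x↔y))

    module Representative (g-invertible : Invertible g) where
      g′ : Mat d
      g′ = proj₁ g-invertible

      g′·g : (g′ · g) ≈M idM
      g′·g = proj₂ (proj₂ g-invertible)

      g·g′ : (g · g′) ≈M idM
      g·g′ = proj₁ (proj₂ g-invertible)

      h′ : Mat d
      h′ = proj₁ (proj₁ h∈B)

      h·h′ : (h · h′) ≈M idM
      h·h′ = proj₁ (proj₂ (proj₁ h∈B))

      h′·h : (h′ · h) ≈M idM
      h′·h = proj₂ (proj₂ (proj₁ h∈B))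

      -- A = gU^{2m} is spanned both by the inner columns of g and by the columns h x with inA x.
      count-inner≤count-inA : count inner ℕ.≤ count inA
      count-inner≤count-inA = left-invertible⇒count-≤ {a = h′ · g} {b = g′ · h}
        (≈M-trans (·-cancel-middle g′ h h′ g h·h′) g′·g)
        (λ y y∉A x x∈I → coordinate-outside h′·h (proj₂ A≡gU2m x (does-true (Inner? x) x∈I)) y
                            (λ y∈A → true≢false (≡.trans (≡.sym (dec-true (InA? y) y∈A)) y∉A)))

      count-inA≤count-inner : count inA ℕ.≤ count inner
      count-inA≤count-inner = left-invertible⇒count-≤ {a = g′ · h} {b = h′ · g}
        (≈M-trans (·-cancel-middle h′ g g′ h g·g′) h′·h)
        (λ y y∉I x x∈A → coordinate-outside g′·g (proj₁ A≡gU2m x (inA-true x∈A)) y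
                            (λ y∈I → true≢false (≡.trans (≡.sym (dec-true (Inner? y) y∈I)) y∉I)))

      τ-permutation : Permutation d d
      τ-permutation = permutation τ τ τ-involutive τ-involutive

      inA∘τ-opposite : ∀ x → inA (τ (o x)) ≡ inA (τ x)
      inA∘τ-opposite x = ≡.trans (≡.cong inA (τ-opposite x)) (inA-dual (τ x))

      count-inner≡count-inA∘τ : count inner ≡ count (inA ∘ τ)
      count-inner≡count-inA∘τ = ≡.trans (ℕP.≤-antisym count-inner≤count-inA count-inA≤count-inner)
                                        (≡.sym (count-permute τ-permutation inA))

      opaque
        inner-matching : Σ[ α ∈ Permutation d d ] (∀ x → inA (τ (α ⟨$⟩ʳ x)) ≡ inner x)
                                              × (∀ x → α ⟨$⟩ʳ o x ≡ o (α ⟨$⟩ʳ x))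
        inner-matching = symmetric-matching N inner (inA ∘ τ) inner-opposite inA∘τ-opposite count-inner≡count-inA∘τ

      β : Permutation d d
      β = proj₁ inner-matching ∘ₚ τ-permutation

      β-inner : ∀ j → inA (β ⟨$⟩ʳ j) ≡ inner j
      β-inner = proj₁ (proj₂ inner-matching)

      β-opposite : ∀ j → β ⟨$⟩ʳ o j ≡ dual (β ⟨$⟩ʳ j)
      β-opposite j = ≡.trans (≡.cong τ (proj₂ (proj₂ inner-matching) j)) (τ-opposite (proj₁ inner-matching ⟨$⟩ʳ j))

      ε-of : (j : Fin d) → Dec (Neg j) → Carrier
      ε-of j (yes _) = 1#
      ε-of j (no _)  = J (o j) j * pairing (β ⟨$⟩ʳ o j)

      ε : Fin d → Carrier
      ε j = ε-of j (toℕ j ℕP.<? N)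

      ε-Neg : ∀ {j} → Neg j → ε j ≈ 1#
      ε-Neg {j} j<N = by-sign (toℕ j ℕP.<? N)
        where
        by-sign : (j<N? : Dec (Neg j)) → ε-of j j<N? ≈ 1#
        by-sign (yes _)   = refl
        by-sign (no j≮N) = ⊥-elim (j≮N j<N)

      ε-¬Neg : ∀ {j} → ¬ Neg j → ε j ≈ J (o j) j * pairing (β ⟨$⟩ʳ o j)
      ε-¬Neg {j} j≮N = by-sign (toℕ j ℕP.<? N)
        where
        by-sign : (j<N? : Dec (Neg j)) → ε-of j j<N? ≈ J (o j) j * pairing (β ⟨$⟩ʳ o j)
        by-sign (yes j<N) = ⊥-elim (j≮N j<N)
        by-sign (no _)    = refl

      ε² : ∀ j → ε j * ε j ≈ 1#
      ε² j = by-sign (toℕ j ℕP.<? N)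
        where
        J² : J (o j) j * J (o j) j ≈ 1#
        J² = ≡.subst (λ y → J (o j) y * J (o j) y ≈ 1#) (Fin.opposite-involutive j) (J-opposite² (o j))
        by-sign : (j<N? : Dec (Neg j)) → ε-of j j<N? * ε-of j j<N? ≈ 1#
        by-sign (yes _) = *-identityˡ 1#
        by-sign (no _)  = trans (interchange _ _ _ _) (trans (*-cong J² (pairing² _)) (*-identityˡ 1#))

      C : Mat d
      C l j = ε j * W l (β ⟨$⟩ʳ j)

      C-invertible : Invertible C
      C-invertible = Invertible-permute-rescale W-invertible β ε ε²

      b κ : Mat d
      b = t · h′
      κ = g′ · (h · C)

      t-invertible : Invertible t
      t-invertible = t , t·t , t·t
        where
        t·t : (t · t) ≈M idM
        t·t z x = t-involutive x z

      b∈B : InB b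
      b∈B = Invertible-· t-invertible (h , h′·h , h·h′) , UpperTriangular-· t-upper (UpperTriangular-inverse (proj₂ h∈B) h·h′)

      κ-column : ∀ i j → κ i j ≈ ε j * (g′ ·ᵥ h ·ᵥ w (β ⟨$⟩ʳ j)) i
      κ-column i j = trans (·ᵥ-cong g′ (·ᵥ-⋆ h (ε j) (w (β ⟨$⟩ʳ j))) i) (·ᵥ-⋆ g′ (ε j) (h ·ᵥ w (β ⟨$⟩ʳ j)) i)

      κ-Inner : ∀ i j → Inner j → ¬ Inner i → κ i j ≈ 0#
      κ-Inner i j j∈I i∉I = trans (κ-column i j) (trans (*-congˡ (coordinate-outside g′·g in-A i i∉I)) (zeroʳ (ε j)))
        where
        βj∈A : InA role (β ⟨$⟩ʳ j)
        βj∈A = inA-true (≡.trans (β-inner j) (dec-true (Inner? j) j∈I))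
        in-A : InSpan Inner (col g) (h ·ᵥ w (β ⟨$⟩ʳ j))
        in-A = InSpan-resp (λ z → sym (h·w-A βj∈A z)) (proj₁ A≡gU2m (β ⟨$⟩ʳ j) βj∈A)

      κ-¬Inner : ∀ i j → ¬ Inner j → Inner i → κ i j ≈ 0#
      κ-¬Inner i j j∉I i∈I = trans (κ-column i j) (trans (*-congˡ (coordinate-outside g′·g in-A' i (λ i∉I → i∉I i∈I))) (zeroʳ (ε j)))
        where
        βj∉A : inA (β ⟨$⟩ʳ j) ≡ false
        βj∉A = ≡.trans (β-inner j) (dec-false (Inner? j) j∉I)
        in-A' : InSpan (λ p → ¬ Inner p) (col g) (h ·ᵥ w (β ⟨$⟩ʳ j))
        in-A' = InSpan-resp (λ z → sym (h·w-A' (λ βj∈A → true≢false (≡.trans (≡.sym (dec-true (InA? _) βj∈A)) βj∉A)) z))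
                            (proj₁ A'≡gU2n (β ⟨$⟩ʳ j) (inA-false βj∉A))

      κ∈K : InK κ
      κ∈K = Invertible-· (g , g′·g , g·g′) (Invertible-· (proj₁ h∈B) C-invertible) , κ-Inner , κ-¬Inner

      X : Mat d
      X = (b · g) · κ

      X≈t·C : X ≈M (t · C)
      X≈t·C = ≈M-trans (·-cancel-middle b g g′ (h · C) g·g′) (·-cancel-middle t h′ h C h′·h)

      X-column : ∀ j → col X j ≈V ε j ⋆ f (β ⟨$⟩ʳ j)
      X-column j z = trans (X≈t·C z j) (trans (·ᵥ-⋆ t (ε j) (w (β ⟨$⟩ʳ j)) z) (*-congˡ (t-w (β ⟨$⟩ʳ j) z)))

      rescaled-pairing : ∀ i → ε i * (ε (o i) * pairing (β ⟨$⟩ʳ i)) ≈ J i (o i)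
      rescaled-pairing i = by-sign (toℕ i ℕP.<? N)
        where
        open ≈-Reasoning
        P = pairing (β ⟨$⟩ʳ i)
        by-sign : Dec (Neg i) → ε i * (ε (o i) * P) ≈ J i (o i)
        by-sign (yes i<N) = begin
          ε i * (ε (o i) * P)                               ≈⟨ *-cong (ε-Neg i<N) (*-congʳ (ε-¬Neg (Neg-opposite i<N))) ⟩
          1# * (J (o (o i)) (o i) * pairing (β ⟨$⟩ʳ o (o i)) * P) ≡⟨ ≡.cong (λ y → 1# * (J y (o i) * pairing (β ⟨$⟩ʳ y) * P)) (Fin.opposite-involutive i) ⟩
          1# * (J i (o i) * P * P)                          ≈⟨ *-identityˡ _ ⟩
          J i (o i) * P * P                                 ≈⟨ *-assoc _ _ _ ⟩
          J i (o i) * (P * P)                               ≈⟨ *-congˡ (pairing² (β ⟨$⟩ʳ i)) ⟩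
          J i (o i) * 1#                                    ≈⟨ *-identityʳ _ ⟩
          J i (o i)                                         ∎
        by-sign (no i≮N) = begin
          ε i * (ε (o i) * P)                               ≈⟨ *-cong (ε-¬Neg i≮N) (*-congʳ (ε-Neg (¬Neg-opposite i≮N))) ⟩
          J (o i) i * pairing (β ⟨$⟩ʳ o i) * (1# * P)       ≈⟨ *-cong (*-congˡ (trans (reflexive (≡.cong pairing (β-opposite i))) (pairing-dual _))) (*-identityˡ P) ⟩
          J (o i) i * - P * P                               ≈⟨ *-congʳ (sym (-‿distribʳ-* _ P)) ⟩
          - (J (o i) i * P) * P                             ≈⟨ sym (-‿distribˡ-* _ P) ⟩
          - (J (o i) i * P * P)                             ≈⟨ -‿cong (trans (*-assoc _ P P) (trans (*-congˡ (pairing² (β ⟨$⟩ʳ i))) (*-identityʳ _))) ⟩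
          - J (o i) i                                       ≈⟨ -‿cong (J-opposite-antisymmetric i) ⟩
          - - J i (o i)                                     ≈⟨ -‿involutive _ ⟩
          J i (o i)                                         ∎

      X-symplectic : (((X ᵀ) · J) · X) ≈M J
      X-symplectic i j = begin
        form J (col X i) (col X j)                                    ≈⟨ form-cong J (X-column i) (X-column j) ⟩
        form J (ε i ⋆ f (β ⟨$⟩ʳ i)) (ε j ⋆ f (β ⟨$⟩ʳ j))              ≈⟨ trans (form-⋆ˡ J (ε i) _ _) (*-congˡ (form-⋆ʳ J (ε j) _ _)) ⟩
        ε i * (ε j * G (β ⟨$⟩ʳ i) (β ⟨$⟩ʳ j))                        ≈⟨ by-cases (j Fin.≟ o i) ⟩
        J i j                                                         ∎
        where
        open ≈-Reasoning
        by-cases : Dec (j ≡ o i) → ε i * (ε j * G (β ⟨$⟩ʳ i) (β ⟨$⟩ʳ j)) ≈ J i j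
        by-cases (yes j≡oi) = ≡.subst (λ y → ε i * (ε y * G (β ⟨$⟩ʳ i) (β ⟨$⟩ʳ y)) ≈ J i y) (≡.sym j≡oi)
          (trans (*-congˡ (*-congˡ (reflexive (≡.cong (G (β ⟨$⟩ʳ i)) (β-opposite i))))) (rescaled-pairing i))
        by-cases (no j≢oi) = trans (*-congˡ (trans (*-congˡ (G-zero (λ βj≡dβi →
                                    j≢oi (Injection.injective (↔⇒↣ β) (≡.trans βj≡dβi (≡.sym (β-opposite i)))))))
                                                  (zeroʳ (ε j))))
                                   (trans (zeroʳ (ε i)) (sym (J-off j≢oi)))

      X∈Gφ : InGφ X
      X∈Gφ = Invertible-· (Invertible-· (proj₁ b∈B) g-invertible) (proj₁ κ∈K) , X-symplectic

proposition5p7 : ∀ {c ℓ} (k : Field c ℓ) → CharNot2 k → (m n : ℕ) →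
    let open Setting k m n in
    (g : Mat d) → Invertible g → (D : Decomposition g) →
    (∀ e → edges D e ⇔ edges D (neg e)) →
    (∀ e → edges D e → ¬ Horizontal e) →
    Σ (Mat d) λ b → Σ (Mat d) λ κ → InB b × InK κ × InGφ ((b · g) · κ)
-- The construction works in every characteristic.
proposition5p7 k _ m n g g-invertible D symmetric horizontal-free = b , κ , b∈B , κ∈K , X∈Gφ
  where open SymplecticForm.Adapted.Representative k m n g D symmetric horizontal-free g-invertible
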